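{- Let $k$ and $n$ be positive integers and let $\sigma\in\mathrm{SIM}(X)$ have disjoint path and cycle decomposition $\sigma=\sigma_1\cdots\sigma_n$ consisting of $n$ paths all of length one (equivalently, $|X|=n$ and $\sigma$ is the empty partial map on $X$). Then \[ r_k(\sigma)=\sum_{\lambda}\frac{n!}{\prod_{a\in\lambda}\mathrm{freq}(a,\lambda)!}, \] where the sum is over all integer partitions $\lambda\vdash n$ with $\max\lambda\leq k$.
   Context: For a finite set $X$, $\mathrm{SIM}(X)$ is the symmetric inverse monoid: the set of all partial one-to-one maps from $X$ to itself, under composition. For distinct $a_1,\dots,a_\ell$, the path $[a_1a_2\cdots a_\ell]$ is the partial map sending $a_i\mapsto a_{i+1}$ for $i<\ell$ and undefined at $a_\ell$ (so $[a]$ is the nowhere-defined map on $\{a\}$); the cycle $(a_1\cdots a_\ell)$ sends $a_i\mapsto a_{i+1}$ for $i<\ell$ and $a_\ell\mapsto a_1$. Its length is $\ell$. Every element of $\mathrm{SIM}(X)$ is uniquely a product of disjoint paths and cycles whose digit sets partition $X$ (its disjoint path and cycle decomposition). $r_k(\sigma)$ is the number of $\alpha\in\mathrm{SIM}(X)$ with $\alpha^k=\sigma$. For an integer partition $\lambda: a_1+\cdots+a_t=n$ into positive parts we write $\lambda\vdash n$, $\max\lambda=\max_i a_i$, and $\mathrm{freq}(a,\lambda)$ is the number of indices $i$ with $a_i=a$; $\prod_{a\in\lambda}$ ranges over the distinct values occurring among the parts. -}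

module Defs where

open import Data.Nat using (ℕ; zero; suc; _+_; _*_; _≤_; _≥_; _≟_; _≤?_; _≥?_; _!; NonZero)
open import Data.Nat.Properties using (m*n≢0; _!≢0)
open import Data.Nat.DivMod using (_/_)
open import Data.Fin using (Fin)
open import Data.Fin.Properties using () renaming (_≟_ to _≟F_; all? to allF?)
open import Data.Nat.ListAction using (sum; product)
open import Data.Maybe using (Maybe; nothing; just; _>>=_)
open import Data.Maybe.Properties using (≡-dec)
open import Data.Vec using (Vec; []; _∷_; lookup)
open import Data.List using (List; []; _∷_; map; concatMap; filter; length; deduplicate; allFin; upTo; applyUpTo)
open import Data.List.Relation.Unary.All using (All) renaming (all? to allL?)
open import Data.List.Relation.Unary.Linked using (Linked; linked?)
open import Data.Product using (_×_)
open import Relation.Nullary using (Dec; yes; no; ¬_; _×-dec_; _→-dec_)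
open import Relation.Binary.PropositionalEquality using (_≡_; _≢_)
open import Function using (_∘_; id)

-- The symmetric inverse monoid SIM(X) with X = Fin n.
-- A partial map X ⇀ X is a function Fin n → Maybe (Fin n);
-- it is an element of SIM(X) iff it is one-to-one on its domain.

PMap : ℕ → Set
PMap n = Fin n → Maybe (Fin n)

IsPartialInjection : ∀ {n} → PMap n → Set
IsPartialInjection {n} f =
  (x y : Fin n) (z : Fin n) → f x ≡ just z → f y ≡ just z → x ≡ y

_∘ₚ_ : ∀ {n} → PMap n → PMap n → PMap n
(g ∘ₚ f) x = f x >>= g

idₚ : ∀ {n} → PMap n
idₚ = just

_^ₚ_ : ∀ {n} → PMap n → ℕ → PMap n
f ^ₚ zero = idₚ
f ^ₚ suc k = f ∘ₚ (f ^ₚ k)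

-- the empty (nowhere defined) partial map on X = Fin n, i.e. [1][2]…[n]
emptyₚ : ∀ {n} → PMap n
emptyₚ _ = nothing

_≈ₚ_ : ∀ {n} → PMap n → PMap n → Set
_≈ₚ_ {n} f g = (x : Fin n) → f x ≡ g x

-- Exhaustive enumeration of all partial maps Fin n ⇀ Fin n
-- (as tables Vec (Maybe (Fin n)) n; each map appears exactly once).

vecsOver : ∀ {A : Set} → List A → (m : ℕ) → List (Vec A m)
vecsOver xs zero = [] ∷ []
vecsOver xs (suc m) = concatMap (λ x → map (x ∷_) (vecsOver xs m)) xs

allPMaps : (n : ℕ) → List (PMap n)
allPMaps n = map lookup (vecsOver (nothing ∷ map just (allFin n)) n)

isPartialInjection? : ∀ {n} (f : PMap n) → Dec (IsPartialInjection f)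
isPartialInjection? f =
  allF? λ x → allF? λ y → allF? λ z →
    ≡-dec _≟F_ (f x) (just z) →-dec (≡-dec _≟F_ (f y) (just z) →-dec (x ≟F y))

≈ₚ? : ∀ {n} (f g : PMap n) → Dec (f ≈ₚ g)
≈ₚ? f g = allF? λ x → ≡-dec _≟F_ (f x) (g x)

r : ∀ {n} → ℕ → PMap n → ℕ
r {n} k σ =
  length (filter (λ α → isPartialInjection? α ×-dec ≈ₚ? (α ^ₚ k) σ) (allPMaps n))

IsPartitionOf : ℕ → List ℕ → Set
IsPartitionOf n λs = All (_≥ 1) λs × Linked _≥_ λs × sum λs ≡ n

MaxAtMost : ℕ → List ℕ → Set
MaxAtMost k λs = All (_≤ k) λs

-- candidate lists: all lists of length ≤ n with entries in {1,…,n};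
-- every partition of n occurs exactly once among them.
candidates : ℕ → List (List ℕ)
candidates n = concatMap (λ m → map Data.Vec.toList (vecsOver (applyUpTo suc n) m)) (upTo (suc n))
  where import Data.Vec

partitionsWithMax≤ : (n k : ℕ) → List (List ℕ)
partitionsWithMax≤ n k =
  filter (λ λs → (allL? (_≥? 1) λs ×-dec (linked? _≥?_ λs ×-dec (sum λs ≟ n)))
                 ×-dec allL? (_≤? k) λs)
         (candidates n)

freq : ℕ → List ℕ → ℕ
freq a λs = length (filter (a ≟_) λs)

freqFactProd : List ℕ → ℕ
freqFactProd λs = product (map (λ a → freq a λs !) (deduplicate _≟_ λs))

freqFactProd≢0 : ∀ λs → NonZero (freqFactProd λs)
freqFactProd≢0 λs = go (deduplicate _≟_ λs)
  where
  go : (xs : List ℕ) → NonZero (product (map (λ a → freq a λs !) xs))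
  go [] = _
  go (x ∷ xs) = m*n≢0 (freq x λs !) _ {{(freq x λs) !≢0}} {{go xs}}

term : ℕ → List ℕ → ℕ
term n λs = (n ! / freqFactProd λs) {{freqFactProd≢0 λs}}

module Submission where

open import Defs
open import Data.Nat using (ℕ; suc)
open import Data.Fin using (Fin)
open import Data.List using (map)
open import Data.Nat.ListAction using (sum)
open import Relation.Binary.PropositionalEquality using (_≡_)
import Relation.Binary.PropositionalEquality as ≡

-- r_K(∅) with K = k+1 counts the partial injections α on n points with α^K = ∅,
-- i.e. the nilpotent partial injections all of whose paths have at most K
-- points.  Both sides of the identity are shown to equal an explicit number
-- nilpotentCount k n defined by a recursion on k:  N_0(m) = 1 and
--   N_{k+1}(n) = Σ_t C(n,t) · falling (n−t) ((k+1)t) · N_k(n − t − (k+1)t),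
-- t being the number of paths with the maximal number k+2 of points.
--
-- Left side (Heights, CompatibleMaps, HeightVectorSums, CountByHeights): each
-- such α has a unique height function h : X → {1..K} (number of points on the
-- path starting at x); the partial injections with a given h number
-- Π_{i≥2} falling #h⁻¹(i−1) #h⁻¹(i), and summing this over h ∈ {1..K}^n by
-- peeling off the points of top height yields the recursion.
--
-- Right side (FrequencyProducts, BoundedPartitions, PartitionSums, Candidates):
-- partitions with parts ≤ K are enumerated by the multiplicity t of the top
-- part; the term n!/Π freq! of (k+2)^t μ factors through the term of μ with
-- the same coefficient as in the recursion.  The statement's enumeration by
-- filtering candidate lists has the same elements, so the sums agree.

module FiniteSums where

  open import Data.Nat
  open import Data.Nat.Properties
  open import Data.Nat.Tactic.RingSolver using (solve-∀)
  open import Algebra.Properties.CommutativeSemigroup +-commutativeSemigroup using () renaming (interchange to +-interchange)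
  open import Data.Nat.ListAction.Properties using (sum-↭)
  open import Data.List using (List; []; _∷_; map; concatMap; filter; length; _++_; applyUpTo)
  open import Data.List.Membership.Propositional using (_∈_; _∉_)
  open import Data.List.Membership.Propositional.Properties.WithK using (unique∧set⇒bag)
  open import Data.List.Relation.Unary.Any using (here; there; _─_)
  open import Data.List.Relation.Unary.All as All using ()
  open import Data.List.Relation.Unary.Unique.Propositional using (Unique)
  open import Data.List.Relation.Unary.AllPairs using (_∷_)
  open import Data.List.Relation.Binary.BagAndSetEquality using (∼bag⇒↭)
  open import Data.List.Relation.Binary.Permutation.Propositional.Properties using () renaming (map⁺ to ↭-map⁺)
  open import Function using (_∘_; mk⇔)
  open import Relation.Nullary using (Dec; yes; no; ¬_; _×-dec_)
  open import Relation.Binary.PropositionalEquality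
  open import Data.Empty using (⊥-elim)
  open ≡-Reasoning

  ∑ : {A : Set} → (A → ℕ) → List A → ℕ
  ∑ f [] = 0
  ∑ f (x ∷ xs) = f x + ∑ f xs

  ∏ : {A : Set} → (A → ℕ) → List A → ℕ
  ∏ f [] = 1
  ∏ f (x ∷ xs) = f x * ∏ f xs

  𝟙 : {P : Set} → Dec P → ℕ
  𝟙 (yes _) = 1
  𝟙 (no _) = 0

  count : ℕ → List ℕ → ℕ
  count i = ∑ (λ a → 𝟙 (a ≟ i))

  𝟙-yes : {P : Set} (p : Dec P) → P → 𝟙 p ≡ 1
  𝟙-yes (yes _) _ = refl
  𝟙-yes (no ¬p) p = ⊥-elim (¬p p)

  𝟙-no : {P : Set} (p : Dec P) → ¬ P → 𝟙 p ≡ 0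
  𝟙-no (yes p) ¬p = ⊥-elim (¬p p)
  𝟙-no (no _) _ = refl

  𝟙-⇔ : {P Q : Set} (p : Dec P) (q : Dec Q) → (P → Q) → (Q → P) → 𝟙 p ≡ 𝟙 q
  𝟙-⇔ (yes _) (yes _) _ _ = refl
  𝟙-⇔ (yes p) (no ¬q) f _ = ⊥-elim (¬q (f p))
  𝟙-⇔ (no ¬p) (yes q) _ g = ⊥-elim (¬p (g q))
  𝟙-⇔ (no _) (no _) _ _ = refl

  𝟙-× : {P Q : Set} (p : Dec P) (q : Dec Q) → 𝟙 (p ×-dec q) ≡ 𝟙 p * 𝟙 q
  𝟙-× (yes _) (yes _) = refl
  𝟙-× (yes _) (no _) = refl
  𝟙-× (no _) _ = refl

  module _ {A : Set} where
    ∑-cong : {f g : A → ℕ} (xs : List A) → (∀ {x} → x ∈ xs → f x ≡ g x) → ∑ f xs ≡ ∑ g xs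
    ∑-cong [] _ = refl
    ∑-cong (x ∷ xs) e = cong₂ _+_ (e (here refl)) (∑-cong xs (e ∘ there))

    ∑-ext : {f g : A → ℕ} (xs : List A) → (∀ x → f x ≡ g x) → ∑ f xs ≡ ∑ g xs
    ∑-ext xs e = ∑-cong xs (λ {x} _ → e x)

    ∑-zero : {f : A → ℕ} (xs : List A) → (∀ {x} → x ∈ xs → f x ≡ 0) → ∑ f xs ≡ 0
    ∑-zero [] _ = refl
    ∑-zero (x ∷ xs) e = cong₂ _+_ (e (here refl)) (∑-zero xs (e ∘ there))

    ∑-++ : (f : A → ℕ) (xs ys : List A) → ∑ f (xs ++ ys) ≡ ∑ f xs + ∑ f ys
    ∑-++ f [] ys = refl
    ∑-++ f (x ∷ xs) ys = trans (cong (f x +_) (∑-++ f xs ys)) (sym (+-assoc (f x) _ _))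

    ∑-+ : (f g : A → ℕ) (xs : List A) → ∑ (λ x → f x + g x) xs ≡ ∑ f xs + ∑ g xs
    ∑-+ f g [] = refl
    ∑-+ f g (x ∷ xs) = trans (cong (f x + g x +_) (∑-+ f g xs)) (+-interchange (f x) (g x) _ _)

    ∑-* : (c : ℕ) (f : A → ℕ) (xs : List A) → ∑ (λ x → c * f x) xs ≡ c * ∑ f xs
    ∑-* c f [] = sym (*-zeroʳ c)
    ∑-* c f (x ∷ xs) = trans (cong (c * f x +_) (∑-* c f xs)) (sym (*-distribˡ-+ c (f x) _))

    ∏-cong : {f g : A → ℕ} (xs : List A) → (∀ {x} → x ∈ xs → f x ≡ g x) → ∏ f xs ≡ ∏ g xs
    ∏-cong [] _ = refl
    ∏-cong (x ∷ xs) e = cong₂ _*_ (e (here refl)) (∏-cong xs (e ∘ there))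

    ∏-1 : (xs : List A) → ∏ (λ _ → 1) xs ≡ 1
    ∏-1 [] = refl
    ∏-1 (x ∷ xs) = trans (+-identityʳ _) (∏-1 xs)

    ∏-++ : (f : A → ℕ) (xs ys : List A) → ∏ f (xs ++ ys) ≡ ∏ f xs * ∏ f ys
    ∏-++ f [] ys = sym (+-identityʳ _)
    ∏-++ f (x ∷ xs) ys = trans (cong (f x *_) (∏-++ f xs ys)) (sym (*-assoc (f x) _ _))

    ∉-─ : {x : A} {ys : List A} (p : x ∈ ys) → Unique ys → x ∉ (ys ─ p)
    ∉-─ (here refl) (x∉ys ∷ _) x∈ = All.lookup x∉ys x∈ refl
    ∉-─ (there p) (y∉ys ∷ _) (here refl) = All.lookup y∉ys p refl
    ∉-─ (there p) (_ ∷ u) (there x∈) = ∉-─ p u x∈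

    ∏-─ : (f : A → ℕ) {x : A} {ys : List A} (p : x ∈ ys) → ∏ f ys ≡ f x * ∏ f (ys ─ p)
    ∏-─ f (here refl) = refl
    ∏-─ f {x} {y ∷ ys} (there p) = begin
      f y * ∏ f ys              ≡⟨ cong (f y *_) (∏-─ f p) ⟩
      f y * (f x * ∏ f (ys ─ p)) ≡⟨ *-left-comm (f y) (f x) _ ⟩
      f x * (f y * ∏ f (ys ─ p)) ∎
      where
      *-left-comm : ∀ a b c → a * (b * c) ≡ b * (a * c)
      *-left-comm = solve-∀

    length-filter : {P : A → Set} (P? : (x : A) → Dec (P x)) (xs : List A) →
      length (filter P? xs) ≡ ∑ (𝟙 ∘ P?) xs
    length-filter P? [] = refl
    length-filter P? (x ∷ xs) with P? x
    ... | yes _ = cong suc (length-filter P? xs)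
    ... | no _ = length-filter P? xs

    count-unique : {P : A → Set} (P? : (x : A) → Dec (P x)) (xs : List A) → Unique xs →
      (∀ {a b} → P a → P b → a ≡ b) → ∀ {a} → a ∈ xs → P a → ∑ (𝟙 ∘ P?) xs ≡ 1
    count-unique P? (x ∷ xs) (x∉xs ∷ _) atMostOne (here refl) px =
      cong₂ _+_ (𝟙-yes (P? x) px)
        (∑-zero xs λ {y} y∈xs → 𝟙-no (P? y) λ py → All.lookup x∉xs y∈xs (atMostOne px py))
    count-unique P? (x ∷ xs) (x∉xs ∷ u) atMostOne (there a∈xs) pa =
      trans (cong (_+ ∑ (𝟙 ∘ P?) xs) (𝟙-no (P? x) λ px → All.lookup x∉xs a∈xs (atMostOne px pa)))
            (count-unique P? xs u atMostOne a∈xs pa)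

    ∑-𝟙-const : {P : A → Set} (P? : (x : A) → Dec (P x)) (g : A → ℕ) (c : ℕ) (xs : List A) →
      (∀ {x} → x ∈ xs → P x → g x ≡ c) → ∑ (λ x → 𝟙 (P? x) * g x) xs ≡ ∑ (𝟙 ∘ P?) xs * c
    ∑-𝟙-const P? g c [] e = refl
    ∑-𝟙-const P? g c (x ∷ xs) e with P? x
    ... | yes px = cong₂ _+_ (trans (+-identityʳ (g x)) (e (here refl) px)) (∑-𝟙-const P? g c xs (e ∘ there))
    ... | no _ = ∑-𝟙-const P? g c xs (e ∘ there)

  module _ {A B : Set} where
    ∑-map : (f : B → ℕ) (g : A → B) (xs : List A) → ∑ f (map g xs) ≡ ∑ (f ∘ g) xs
    ∑-map f g [] = refl
    ∑-map f g (x ∷ xs) = cong (f (g x) +_) (∑-map f g xs)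

    ∑-concatMap : (f : B → ℕ) (g : A → List B) (xs : List A) →
      ∑ f (concatMap g xs) ≡ ∑ (λ x → ∑ f (g x)) xs
    ∑-concatMap f g [] = refl
    ∑-concatMap f g (x ∷ xs) = trans (∑-++ f (g x) (concatMap g xs)) (cong (∑ f (g x) +_) (∑-concatMap f g xs))

    ∑-swap : (f : A → B → ℕ) (xs : List A) (ys : List B) →
      ∑ (λ x → ∑ (f x) ys) xs ≡ ∑ (λ y → ∑ (λ x → f x y) xs) ys
    ∑-swap f [] ys = sym (∑-zero ys (λ _ → refl))
    ∑-swap f (x ∷ xs) ys = trans (cong (∑ (f x) ys +_) (∑-swap f xs ys)) (sym (∑-+ (f x) _ ys))

  sum-map : {A : Set} (f : A → ℕ) (xs : List A) → sum (map f xs) ≡ ∑ f xs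
  sum-map f [] = refl
  sum-map f (x ∷ xs) = cong (f x +_) (sum-map f xs)

  ∑-unique : {A : Set} (f : A → ℕ) (xs ys : List A) → Unique xs → Unique ys →
    (∀ {z} → z ∈ xs → z ∈ ys) → (∀ {z} → z ∈ ys → z ∈ xs) → ∑ f xs ≡ ∑ f ys
  ∑-unique f xs ys ux uy to from = begin
    ∑ f xs          ≡⟨ sum-map f xs ⟨
    sum (map f xs)  ≡⟨ sum-↭ (↭-map⁺ f (∼bag⇒↭ (unique∧set⇒bag ux uy (mk⇔ to from)))) ⟩
    sum (map f ys)  ≡⟨ sum-map f ys ⟩
    ∑ f ys          ∎

  ∑< : ℕ → (ℕ → ℕ) → ℕ
  ∑< zero f = 0
  ∑< (suc m) f = f 0 + ∑< m (f ∘ suc)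

  ∑<-cong : ∀ m {f g : ℕ → ℕ} → (∀ t → t < m → f t ≡ g t) → ∑< m f ≡ ∑< m g
  ∑<-cong zero e = refl
  ∑<-cong (suc m) e = cong₂ _+_ (e 0 z<s) (∑<-cong m (λ t t<m → e (suc t) (s<s t<m)))

  ∑<-zero : ∀ m {f : ℕ → ℕ} → (∀ t → t < m → f t ≡ 0) → ∑< m f ≡ 0
  ∑<-zero m e = trans (∑<-cong m e) (zeros m)
    where
    zeros : ∀ m → ∑< m (λ _ → 0) ≡ 0
    zeros zero = refl
    zeros (suc m) = zeros m

  ∑<-snoc : ∀ m (f : ℕ → ℕ) → ∑< (suc m) f ≡ ∑< m f + f m
  ∑<-snoc zero f = +-comm (f 0) 0
  ∑<-snoc (suc m) f = trans (cong (f 0 +_) (∑<-snoc m (f ∘ suc))) (sym (+-assoc (f 0) _ _))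

  ∑<-+ : ∀ m (f g : ℕ → ℕ) → ∑< m (λ t → f t + g t) ≡ ∑< m f + ∑< m g
  ∑<-+ zero f g = refl
  ∑<-+ (suc m) f g = trans (cong (f 0 + g 0 +_) (∑<-+ m (f ∘ suc) (g ∘ suc))) (+-interchange (f 0) (g 0) _ _)

  ∑<-* : ∀ m c (f : ℕ → ℕ) → ∑< m (λ t → c * f t) ≡ c * ∑< m f
  ∑<-* zero c f = sym (*-zeroʳ c)
  ∑<-* (suc m) c f = trans (cong (c * f 0 +_) (∑<-* m c (f ∘ suc))) (sym (*-distribˡ-+ c (f 0) _))

  ∑<-split : ∀ u m (f : ℕ → ℕ) → ∑< (u + m) f ≡ ∑< u f + ∑< m (λ s → f (u + s))
  ∑<-split zero m f = refl
  ∑<-split (suc u) m f = trans (cong (f 0 +_) (∑<-split u m (f ∘ suc))) (sym (+-assoc (f 0) _ _))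

  ∑-∑< : {A : Set} (m : ℕ) (f : A → ℕ → ℕ) (xs : List A) → ∑ (λ x → ∑< m (f x)) xs ≡ ∑< m (λ t → ∑ (λ x → f x t) xs)
  ∑-∑< zero f xs = ∑-zero xs (λ _ → refl)
  ∑-∑< (suc m) f xs = trans (∑-+ (λ x → f x 0) (λ x → ∑< m (f x ∘ suc)) xs) (cong (∑ (λ x → f x 0) xs +_) (∑-∑< m (λ x → f x ∘ suc) xs))

  ∑-applyUpTo : (f g : ℕ → ℕ) (m : ℕ) → ∑ f (applyUpTo g m) ≡ ∑< m (f ∘ g)
  ∑-applyUpTo f g zero = refl
  ∑-applyUpTo f g (suc m) = cong (f (g 0) +_) (∑-applyUpTo f (g ∘ suc) m)

module VectorEnumeration where

  open import Data.Nat using (ℕ; zero; suc; _+_)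
  open import Data.Nat.Properties using (+-identityʳ)
  open import Data.List using (List; []; _∷_; map; concatMap; allFin; tabulate)
  open import Data.List.Properties using (map-tabulate)
  open import Data.List.Membership.Propositional using (_∈_; find; lose)
  open import Data.List.Membership.Propositional.Properties using (∈-concatMap⁺; ∈-concatMap⁻; ∈-map⁺; ∈-map⁻)
  open import Data.List.Relation.Unary.Any using (here)
  open import Data.List.Relation.Unary.All as All using ([]; _∷_)
  open import Data.List.Relation.Unary.Unique.Propositional using (Unique)
  open import Data.List.Relation.Unary.Unique.Propositional.Properties using (++⁺; map⁺)
  open import Data.List.Relation.Unary.AllPairs using ([]; _∷_)
  open import Data.Vec using (Vec; []; _∷_; replicate; lookup; toList)
  open import Data.Vec.Properties using (∷-injective)
  open import Data.Vec.Relation.Unary.All as VAll using ([]; _∷_)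
  open import Data.Product using (_×_; _,_; proj₁; proj₂; ∃)
  open import Relation.Nullary using (¬_)
  open import Relation.Binary.PropositionalEquality
  open import Function using (_∘_; id)
  open import Defs using (vecsOver)
  open FiniteSums

  module _ {A B : Set} where
    ∈-concatMap-intro : {g : A → List B} {xs : List A} {x : A} {v : B} → x ∈ xs → v ∈ g x → v ∈ concatMap g xs
    ∈-concatMap-intro {g} x∈xs v∈gx = ∈-concatMap⁺ g (lose x∈xs v∈gx)

    ∈-concatMap-elim : {g : A → List B} (xs : List A) {v : B} → v ∈ concatMap g xs → ∃ λ x → x ∈ xs × v ∈ g x
    ∈-concatMap-elim {g} xs v∈ = find (∈-concatMap⁻ g v∈)

    unique-concatMap : {g : A → List B} (xs : List A) → Unique xs → (∀ x → Unique (g x)) →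
      (∀ {x y v} → v ∈ g x → v ∈ g y → x ≡ y) → Unique (concatMap g xs)
    unique-concatMap [] _ _ _ = []
    unique-concatMap {g} (x ∷ xs) (x∉xs ∷ u) ug disjoint = ++⁺ (ug x) (unique-concatMap xs u ug disjoint) apart
      where
      apart : ∀ {v} → ¬ (v ∈ g x × v ∈ concatMap g xs)
      apart (v∈gx , v∈rest) with ∈-concatMap-elim {g = g} xs v∈rest
      ... | y , y∈xs , v∈gy = All.lookup x∉xs y∈xs (disjoint v∈gx v∈gy)

  module _ {A : Set} where
    private
      cons-blocks : List A → (m : ℕ) → A → List (Vec A (suc m))
      cons-blocks xs m x = map (x ∷_) (vecsOver xs m)

    ∈-vecsOver : (xs : List A) {m : ℕ} (v : Vec A m) → VAll.All (_∈ xs) v → v ∈ vecsOver xs m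
    ∈-vecsOver xs [] [] = here refl
    ∈-vecsOver xs (x ∷ v) (x∈ ∷ v∈) =
      ∈-concatMap-intro {g = cons-blocks xs _} x∈ (∈-map⁺ (x ∷_) (∈-vecsOver xs v v∈))

    vecsOver-∈ : (xs : List A) {m : ℕ} (v : Vec A m) → v ∈ vecsOver xs m → VAll.All (_∈ xs) v
    vecsOver-∈ xs [] _ = []
    vecsOver-∈ xs {suc m} (x ∷ v) v∈ with ∈-concatMap-elim {g = cons-blocks xs m} xs v∈
    ... | y , y∈xs , w∈ with ∈-map⁻ (y ∷_) w∈
    ... | w , w∈' , refl = y∈xs ∷ vecsOver-∈ xs v w∈'

    unique-vecsOver : (xs : List A) (m : ℕ) → Unique xs → Unique (vecsOver xs m)
    unique-vecsOver xs zero u = [] ∷ []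
    unique-vecsOver xs (suc m) u =
      unique-concatMap xs u (λ x → map⁺ (λ e → proj₂ (∷-injective e)) (unique-vecsOver xs m u)) sameHead
      where
      sameHead : ∀ {x y v} → v ∈ cons-blocks xs m x → v ∈ cons-blocks xs m y → x ≡ y
      sameHead {x} {y} p q with ∈-map⁻ (x ∷_) p | ∈-map⁻ (y ∷_) q
      ... | _ , _ , refl | _ , _ , e = proj₁ (∷-injective e)

    ∑-vecsOver : (xs : List A) (m : ℕ) (f : Vec A (suc m) → ℕ) →
      ∑ f (vecsOver xs (suc m)) ≡ ∑ (λ x → ∑ (λ v → f (x ∷ v)) (vecsOver xs m)) xs
    ∑-vecsOver xs m f = trans (∑-concatMap f (cons-blocks xs m) xs)
      (∑-ext xs (λ x → ∑-map f (x ∷_) (vecsOver xs m)))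

    ∑-allFin-lookup : ∀ {m} (h : Vec A m) (f : A → ℕ) → ∑ (f ∘ lookup h) (allFin m) ≡ ∑ f (toList h)
    ∑-allFin-lookup {m} h f = trans (sym (∑-map f (lookup h) (allFin m)))
      (trans (cong (∑ f) (map-tabulate id (lookup h))) (entries h))
      where
      entries : ∀ {m} (h : Vec A m) → ∑ f (tabulate (lookup h)) ≡ ∑ f (toList h)
      entries [] = refl
      entries (x ∷ h) = cong (f x +_) (entries h)

    ∑-vecsOver-single : (x : A) (m : ℕ) (f : Vec A m → ℕ) → ∑ f (vecsOver (x ∷ []) m) ≡ f (replicate m x)
    ∑-vecsOver-single x zero f = +-identityʳ _
    ∑-vecsOver-single x (suc m) f =
      trans (∑-vecsOver (x ∷ []) m f) (trans (+-identityʳ _) (∑-vecsOver-single x m (λ v → f (x ∷ v))))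

module Binomials where

  open import Data.Nat
  open import Data.Nat.Properties
  open import Relation.Binary.PropositionalEquality
  open FiniteSums using (∑<; ∑<-cong; ∑<-snoc; ∑<-+)
  open ≡-Reasoning

  -- falling n k = n (n−1) ⋯ (n−k+1), the number of injections of a k-set into an n-set.
  falling : ℕ → ℕ → ℕ
  falling n zero = 1
  falling zero (suc k) = 0
  falling (suc n) (suc k) = suc n * falling n k

  choose : ℕ → ℕ → ℕ
  choose n zero = 1
  choose zero (suc k) = 0
  choose (suc n) (suc k) = choose n k + choose n (suc k)

  choose-zero : ∀ n k → n < k → choose n k ≡ 0
  choose-zero zero (suc k) _ = refl
  choose-zero (suc n) (suc k) (s≤s n<k) = cong₂ _+_ (choose-zero n k n<k) (choose-zero n (suc k) (m≤n⇒m≤1+n n<k))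

  falling-zero : ∀ n k → n < k → falling n k ≡ 0
  falling-zero zero (suc k) _ = refl
  falling-zero (suc n) (suc k) (s≤s n<k) = trans (cong (suc n *_) (falling-zero n k n<k)) (*-zeroʳ (suc n))

  falling-pred : ∀ n k → n * falling (pred n) k ≡ falling n (suc k)
  falling-pred zero k = refl
  falling-pred (suc n) k = refl

  choose-1 : ∀ n → choose n 1 ≡ n
  choose-1 zero = refl
  choose-1 (suc n) = cong suc (choose-1 n)

  choose-absorb : ∀ n k → choose (suc n) (suc k) * suc k ≡ suc n * choose n k
  choose-absorb zero zero = refl
  choose-absorb zero (suc k) = refl
  choose-absorb (suc n) zero = trans (*-identityʳ _) (trans (choose-1 (suc (suc n))) (sym (*-identityʳ (suc (suc n)))))
  choose-absorb (suc n) (suc k) = begin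
      (choose (suc n) (suc k) + choose (suc n) (suc (suc k))) * suc (suc k)
        ≡⟨ *-distribʳ-+ (suc (suc k)) (choose (suc n) (suc k)) _ ⟩
      choose (suc n) (suc k) * suc (suc k) + choose (suc n) (suc (suc k)) * suc (suc k)
        ≡⟨ cong (choose (suc n) (suc k) * suc (suc k) +_) (choose-absorb n (suc k)) ⟩
      choose (suc n) (suc k) * suc (suc k) + suc n * choose n (suc k)
        ≡⟨ cong (_+ suc n * choose n (suc k)) (trans (*-suc (choose (suc n) (suc k)) (suc k)) (cong (choose (suc n) (suc k) +_) (choose-absorb n k))) ⟩
      choose (suc n) (suc k) + suc n * choose n k + suc n * choose n (suc k)
        ≡⟨ +-assoc (choose (suc n) (suc k)) _ _ ⟩
      choose (suc n) (suc k) + (suc n * choose n k + suc n * choose n (suc k))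
        ≡⟨ cong (choose (suc n) (suc k) +_) (sym (*-distribˡ-+ (suc n) (choose n k) (choose n (suc k)))) ⟩
      choose (suc n) (suc k) + suc n * choose (suc n) (suc k) ≡⟨ refl ⟩
      suc (suc n) * choose (suc n) (suc k) ∎

  choose-! : ∀ m s → choose m s * s ! ≡ falling m s
  choose-! m zero = refl
  choose-! zero (suc s) = refl
  choose-! (suc m) (suc s) = begin
      choose (suc m) (suc s) * (suc s * s !) ≡⟨ sym (*-assoc (choose (suc m) (suc s)) (suc s) (s !)) ⟩
      choose (suc m) (suc s) * suc s * s ! ≡⟨ cong (_* s !) (choose-absorb m s) ⟩
      suc m * choose m s * s ! ≡⟨ *-assoc (suc m) (choose m s) (s !) ⟩
      suc m * (choose m s * s !) ≡⟨ cong (suc m *_) (choose-! m s) ⟩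
      suc m * falling m s ∎

  -- Choosing a+b injective values in two stages.
  falling-+ : ∀ n a b → falling n (a + b) ≡ falling n a * falling (n ∸ a) b
  falling-+ n zero b = sym (+-identityʳ (falling n b))
  falling-+ zero (suc a) b = refl
  falling-+ (suc n) (suc a) b = trans (cong (suc n *_) (falling-+ n a b)) (sym (*-assoc (suc n) (falling n a) _))

  falling-! : ∀ a b → b ≤ a → falling a b * (a ∸ b) ! ≡ a !
  falling-! a zero _ = +-identityʳ (a !)
  falling-! (suc a) (suc b) (s≤s le) = trans (*-assoc (suc a) (falling a b) _) (cong (suc a *_) (falling-! a b le))

  -- C(m,s)·falling (m−s) a = falling m a · C(m−a,s): both sides count an s-subset
  -- together with an ordered a-tuple of distinct elements outside it.
  choose-falling : ∀ m s a → choose m s * falling (m ∸ s) a ≡ falling m a * choose (m ∸ a) s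
  choose-falling m s a = *-cancelʳ-≡ _ _ (s !) {{(s !≢0)}} (begin
      choose m s * falling (m ∸ s) a * s ! ≡⟨ *-assoc (choose m s) _ _ ⟩
      choose m s * (falling (m ∸ s) a * s !) ≡⟨ cong (choose m s *_) (*-comm (falling (m ∸ s) a) (s !)) ⟩
      choose m s * (s ! * falling (m ∸ s) a) ≡⟨ sym (*-assoc (choose m s) _ _) ⟩
      choose m s * s ! * falling (m ∸ s) a ≡⟨ cong (_* falling (m ∸ s) a) (choose-! m s) ⟩
      falling m s * falling (m ∸ s) a ≡⟨ sym (falling-+ m s a) ⟩
      falling m (s + a) ≡⟨ cong (falling m) (+-comm s a) ⟩
      falling m (a + s) ≡⟨ falling-+ m a s ⟩
      falling m a * falling (m ∸ a) s ≡⟨ cong (falling m a *_) (sym (choose-! (m ∸ a) s)) ⟩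
      falling m a * (choose (m ∸ a) s * s !) ≡⟨ sym (*-assoc (falling m a) _ _) ⟩
      falling m a * choose (m ∸ a) s * s ! ∎)

  choose-falling-split : ∀ n u s → choose n (u + s) * falling (u + s) u ≡ falling n u * choose (n ∸ u) s
  choose-falling-split n zero s = trans (*-identityʳ (choose n s)) (sym (+-identityʳ (choose n s)))
  choose-falling-split zero (suc u) s = refl
  choose-falling-split (suc n) (suc u) s = begin
      choose (suc n) (suc (u + s)) * (suc (u + s) * falling (u + s) u) ≡⟨ sym (*-assoc (choose (suc n) (suc (u + s))) _ _) ⟩
      choose (suc n) (suc (u + s)) * suc (u + s) * falling (u + s) u ≡⟨ cong (_* falling (u + s) u) (choose-absorb n (u + s)) ⟩
      suc n * choose n (u + s) * falling (u + s) u ≡⟨ *-assoc (suc n) (choose n (u + s)) (falling (u + s) u) ⟩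
      suc n * (choose n (u + s) * falling (u + s) u) ≡⟨ cong (suc n *_) (choose-falling-split n u s) ⟩
      suc n * (falling n u * choose (n ∸ u) s) ≡⟨ sym (*-assoc (suc n) (falling n u) (choose (n ∸ u) s)) ⟩
      suc n * falling n u * choose (n ∸ u) s ∎

  -- Regrouping the coefficient of a shifted term: first pick u + s points, then
  -- order u of them, then a + b further points  =  order u + a points first.
  choose-falling-regroup : ∀ n u s a b → choose n (u + s) * falling (u + s) u * falling (n ∸ (u + s)) (a + b) ≡ falling n (u + a) * (choose (n ∸ (u + a)) s * falling (n ∸ (u + a) ∸ s) b)
  choose-falling-regroup n u s a b = begin
      choose n (u + s) * falling (u + s) u * falling (n ∸ (u + s)) (a + b)
        ≡⟨ cong₂ _*_ (choose-falling-split n u s) (cong (λ z → falling z (a + b)) (sym (∸-+-assoc n u s))) ⟩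
      falling n u * choose m s * falling (m ∸ s) (a + b)
        ≡⟨ cong (falling n u * choose m s *_) (falling-+ (m ∸ s) a b) ⟩
      falling n u * choose m s * (falling (m ∸ s) a * falling (m ∸ s ∸ a) b)
        ≡⟨ trans (*-assoc (falling n u) (choose m s) _) (cong (falling n u *_) (sym (*-assoc (choose m s) (falling (m ∸ s) a) _))) ⟩
      falling n u * (choose m s * falling (m ∸ s) a * falling (m ∸ s ∸ a) b)
        ≡⟨ cong (λ z → falling n u * (z * falling (m ∸ s ∸ a) b)) (choose-falling m s a) ⟩
      falling n u * (falling m a * choose (m ∸ a) s * falling (m ∸ s ∸ a) b)
        ≡⟨ cong (λ z → falling n u * (falling m a * choose (m ∸ a) s * falling z b)) m∸s∸a ⟩
      falling n u * (falling m a * choose (m ∸ a) s * falling (m ∸ a ∸ s) b)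
        ≡⟨ trans (cong (falling n u *_) (*-assoc (falling m a) _ _)) (sym (*-assoc (falling n u) (falling m a) _)) ⟩
      falling n u * falling m a * (choose (m ∸ a) s * falling (m ∸ a ∸ s) b)
        ≡⟨ cong₂ _*_ (sym (falling-+ n u a)) (cong (λ z → choose z s * falling (z ∸ s) b) (∸-+-assoc n u a)) ⟩
      falling n (u + a) * (choose (n ∸ (u + a)) s * falling (n ∸ (u + a) ∸ s) b) ∎
    where
    m : ℕ
    m = n ∸ u
    m∸s∸a : m ∸ s ∸ a ≡ m ∸ a ∸ s
    m∸s∸a = trans (∸-+-assoc m s a) (trans (cong (m ∸_) (+-comm s a)) (sym (∸-+-assoc m a s)))


  -- Pascal's rule inside a convolution:  C(n+1,t) = C(n,t) + C(n,t−1)  splits a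
  -- weighted sum over t ≤ n+1 into the two sums obtained by deciding whether a
  -- distinguished element is counted by t.
  pascal-convolution : ∀ n (W : ℕ → ℕ → ℕ) →
    ∑< (suc n) (λ t → choose n t * W (suc (n ∸ t)) t) + ∑< (suc n) (λ t → choose n t * W (n ∸ t) (suc t))
    ≡ ∑< (suc (suc n)) (λ t → choose (suc n) t * W (suc n ∸ t) t)
  pascal-convolution n W = begin
    ∑< (suc n) (λ t → choose n t * W (suc (n ∸ t)) t) + B
      ≡⟨ cong (λ z → z + ∑< n (λ t → choose n (suc t) * W (suc (n ∸ suc t)) (suc t)) + B) (*-identityˡ (W (suc n) 0)) ⟩
    W (suc n) 0 + ∑< n (λ t → choose n (suc t) * W (suc (n ∸ suc t)) (suc t)) + B
      ≡⟨ cong (λ z → W (suc n) 0 + z + B) shiftedTail ⟩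
    W (suc n) 0 + B′ + B                          ≡⟨ +-assoc (W (suc n) 0) B′ B ⟩
    W (suc n) 0 + (B′ + B)                        ≡⟨ cong (W (suc n) 0 +_) (+-comm B′ B) ⟩
    W (suc n) 0 + (B + B′)                        ≡⟨ cong (W (suc n) 0 +_) (∑<-+ (suc n) (λ t → choose n t * W (n ∸ t) (suc t)) (λ t → choose n (suc t) * W (n ∸ t) (suc t))) ⟨
    W (suc n) 0 + ∑< (suc n) (λ t → choose n t * W (n ∸ t) (suc t) + choose n (suc t) * W (n ∸ t) (suc t))
      ≡⟨ cong₂ _+_ (sym (*-identityˡ (W (suc n) 0)))
                   (∑<-cong (suc n) (λ t _ → sym (*-distribʳ-+ (W (n ∸ t) (suc t)) (choose n t) (choose n (suc t))))) ⟩
    ∑< (suc (suc n)) (λ t → choose (suc n) t * W (suc n ∸ t) t) ∎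
    where
    B B′ : ℕ
    B = ∑< (suc n) (λ t → choose n t * W (n ∸ t) (suc t))
    B′ = ∑< (suc n) (λ t → choose n (suc t) * W (n ∸ t) (suc t))
    -- The extra last term of B′ vanishes because C(n,n+1) = 0.
    shiftedTail : ∑< n (λ t → choose n (suc t) * W (suc (n ∸ suc t)) (suc t)) ≡ B′
    shiftedTail = sym (begin
      B′ ≡⟨ ∑<-snoc n _ ⟩
      ∑< n (λ t → choose n (suc t) * W (n ∸ t) (suc t)) + choose n (suc n) * W (n ∸ n) (suc n)
        ≡⟨ cong (λ z → ∑< n (λ t → choose n (suc t) * W (n ∸ t) (suc t)) + z * W (n ∸ n) (suc n)) (choose-zero n (suc n) ≤-refl) ⟩
      ∑< n (λ t → choose n (suc t) * W (n ∸ t) (suc t)) + 0 ≡⟨ +-identityʳ _ ⟩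
      ∑< n (λ t → choose n (suc t) * W (n ∸ t) (suc t))
        ≡⟨ ∑<-cong n (λ t t<n → cong (λ z → choose n (suc t) * W z (suc t)) (+-∸-assoc 1 t<n)) ⟩
      ∑< n (λ t → choose n (suc t) * W (suc (n ∸ suc t)) (suc t)) ∎)

-- For a partial map α, a height function assigns to each point x the
-- number of points on the α-path starting at x:  h x = 1 if α x is undefined and
-- h x = 1 + h (α x) otherwise.
module Heights where

  open import Data.Nat
  open import Data.Nat.Properties
  open import Data.Fin using (Fin)
  open import Data.Maybe using (Maybe; nothing; just; _>>=_)
  open import Relation.Binary.PropositionalEquality
  open import Data.Product using (_,_)

  HeightAt : ∀ {n} → ℕ → Maybe (Fin n) → (Fin n → ℕ) → Set
  HeightAt hx nothing h = hx ≡ 1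
  HeightAt hx (just y) h = hx ≡ suc (h y)

  module _ {n : ℕ} (α : PMap n) where

    ^ₚ-unfold : ∀ j x → (α ^ₚ suc j) x ≡ (α x >>= (α ^ₚ j))
    ^ₚ-unfold zero x with α x
    ... | nothing = refl
    ... | just y = refl
    ^ₚ-unfold (suc j) x rewrite ^ₚ-unfold j x with α x
    ... | nothing = refl
    ... | just y = refl

    ^ₚ-via : ∀ j {x y} → α x ≡ just y → (α ^ₚ suc j) x ≡ (α ^ₚ j) y
    ^ₚ-via j {x} e = trans (^ₚ-unfold j x) (cong (_>>= (α ^ₚ j)) e)

    ^ₚ-undefined-mono : ∀ j k x → (α ^ₚ j) x ≡ nothing → j ≤ k → (α ^ₚ k) x ≡ nothing
    ^ₚ-undefined-mono j k x e j≤k with m≤n⇒∃[o]m+o≡n j≤k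
    ... | o , refl = go o
      where
      go : ∀ o → (α ^ₚ (j + o)) x ≡ nothing
      go zero rewrite +-identityʳ j = e
      go (suc o) rewrite +-suc j o | go o = refl

    IsHeight : (Fin n → ℕ) → Set
    IsHeight h = ∀ x → HeightAt (h x) (α x) h

    height-unique : ∀ h h' → IsHeight h → IsHeight h' → ∀ x → h x ≡ h' x
    height-unique h h' isH isH' x = go (h x) x ≤-refl
      where
      go : ∀ bound x → h x ≤ bound → h x ≡ h' x
      go bound x hx≤ with α x | isH x | isH' x
      ... | nothing | e | e' = trans e (sym e')
      go (suc bound) x hx≤ | just y | e | e' =
        trans e (trans (cong suc (go bound y (≤-pred (subst (_≤ suc bound) e hx≤)))) (sym e'))
      go zero x hx≤ | just y | e | e' with subst (_≤ 0) e hx≤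
      ... | ()

    height-kills : ∀ h → IsHeight h → ∀ x → (α ^ₚ h x) x ≡ nothing
    height-kills h isH x = go (h x) x ≤-refl
      where
      go : ∀ bound x → h x ≤ bound → (α ^ₚ h x) x ≡ nothing
      go bound x hx≤ with α x in αx | isH x
      ... | nothing | e rewrite e = αx
      go (suc bound) x hx≤ | just y | e rewrite e = trans (^ₚ-via (h y) αx) (go bound y (≤-pred hx≤))
      go zero x hx≤ | just y | e with subst (_≤ 0) e hx≤
      ... | ()

    IsHeight-resp : ∀ h h' → (∀ x → h x ≡ h' x) → IsHeight h → IsHeight h'
    IsHeight-resp h h' e isH x with α x | isH x
    ... | nothing | hx = trans (sym (e x)) hx
    ... | just y | hx = trans (sym (e x)) (trans hx (cong suc (e y)))

    bounded-height⇒nilpotent : ∀ K h → IsHeight h → (∀ x → h x ≤ K) → (α ^ₚ K) ≈ₚ emptyₚ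
    bounded-height⇒nilpotent K h isH bounded x = ^ₚ-undefined-mono (h x) K x (height-kills h isH x) (bounded x)

    -- The path length from x, computed with a fuel bound f on the number of steps.
    height : ℕ → Fin n → ℕ
    height-from : ℕ → Maybe (Fin n) → ℕ
    height zero x = 1
    height (suc f) x = height-from f (α x)
    height-from f nothing = 1
    height-from f (just y) = suc (height f y)

    height-stable : ∀ j f g x → (α ^ₚ j) x ≡ nothing → j ≤ f → j ≤ g → height f x ≡ height g x
    height-stable zero f g x () _ _
    height-stable (suc j) (suc f) (suc g) x e (s≤s j≤f) (s≤s j≤g) with α x in αx
    ... | nothing = refl
    ... | just y = cong suc (height-stable j f g y (trans (sym (^ₚ-via j αx)) e) j≤f j≤g)

    height-≤ : ∀ j f x → (α ^ₚ j) x ≡ nothing → j ≤ f → height f x ≤ j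
    height-≤ zero f x () _
    height-≤ (suc j) (suc f) x e (s≤s j≤f) with α x in αx
    ... | nothing = s≤s z≤n
    ... | just y = s≤s (height-≤ j f y (trans (sym (^ₚ-via j αx)) e) j≤f)

    height-pos : ∀ f x → 1 ≤ height f x
    height-pos zero x = s≤s z≤n
    height-pos (suc f) x with α x
    ... | nothing = s≤s z≤n
    ... | just y = s≤s z≤n

    nilpotent⇒height : ∀ k → (α ^ₚ suc k) ≈ₚ emptyₚ → IsHeight (height (suc k))
    nilpotent⇒height k nil x with α x in αx
    ... | nothing = refl
    ... | just y = cong suc (height-stable k k (suc k) y (trans (sym (^ₚ-via k αx)) (nil x)) ≤-refl (n≤1+n k))

    nilpotent⇒height-≤ : ∀ K → (α ^ₚ K) ≈ₚ emptyₚ → ∀ x → height K x ≤ K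
    nilpotent⇒height-≤ K nil x = height-≤ K K x (nil x) ≤-refl

-- Fix τ : X → ℕ, the
-- intended height of every point.  A table v assigns to each point of a list of
-- heights hs either "undefined" (allowed only at height 1) or an unused point y
-- with τ y + 1 equal to that height.  With U the list of points used so far,
-- the number of such tables is  Π_i falling (free U i) (count i hs):  the
-- points of height i are sent injectively into the free points of height i − 1.
module CompatibleMaps {n : ℕ} (τ : Fin n → ℕ) where

  open import Data.Nat
  open import Data.Nat.Properties
  open import Data.Fin using (Fin; zero; suc) renaming (_≟_ to _≟F_)
  open import Data.Fin.Properties using () renaming (suc-injective to Fin-suc-injective)
  open import Data.Maybe using (Maybe; nothing; just)
  open import Data.List using (List; []; _∷_; map; allFin)
  open import Data.List.Membership.Propositional using (_∈_; _∉_)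
  open import Data.List.Membership.Propositional.Properties using (∈-allFin)
  open import Data.List.Membership.DecPropositional (_≟F_ {n}) using (_∈?_)
  open import Data.List.Relation.Unary.Any using (here; there; _─_)
  open import Data.List.Relation.Unary.Unique.Propositional using (Unique)
  open import Data.List.Relation.Unary.Unique.Propositional.Properties using (allFin⁺)
  open import Data.Vec using (Vec; []; _∷_; lookup; toList)
  open import Data.Vec.Relation.Unary.All as VAll using (_∷_)
  open import Relation.Nullary using (Dec; yes; no; ¬?; _×-dec_)
  open import Relation.Binary.PropositionalEquality
  open import Data.Product using (_×_; _,_)
  open import Data.Sum using (_⊎_; inj₁; inj₂)
  open import Data.Unit using (⊤; tt)
  open import Data.Empty using (⊥-elim)
  open import Function using (_∘_)
  open import Defs using (vecsOver)
  open FiniteSums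
  open VectorEnumeration
  open Binomials
  open Heights using (HeightAt)
  open ≡-Reasoning

  targets : List (Maybe (Fin n))
  targets = nothing ∷ map just (allFin n)

  Free : List (Fin n) → ℕ → Fin n → Set
  Free U i y = i ≡ suc (τ y) × y ∉ U

  free? : ∀ U i y → Dec (Free U i y)
  free? U i y = (i ≟ suc (τ y)) ×-dec ¬? (y ∈? U)

  free : List (Fin n) → ℕ → ℕ
  free U i = ∑ (𝟙 ∘ free? U i) (allFin n)

  Compatible : List (Fin n) → ∀ {m} → Vec ℕ m → Vec (Maybe (Fin n)) m → Set
  Compatible U [] [] = ⊤
  Compatible U (a ∷ hs) (nothing ∷ v) = a ≡ 1 × Compatible U hs v
  Compatible U (a ∷ hs) (just y ∷ v) = Free U a y × Compatible (y ∷ U) hs v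

  compatible? : ∀ U {m} (hs : Vec ℕ m) v → Dec (Compatible U hs v)
  compatible? U [] [] = yes tt
  compatible? U (a ∷ hs) (nothing ∷ v) = (a ≟ 1) ×-dec compatible? U hs v
  compatible? U (a ∷ hs) (just y ∷ v) = free? U a y ×-dec compatible? (y ∷ U) hs v

  injectionCount : List (Fin n) → ∀ {m} → Vec ℕ m → List ℕ → ℕ
  injectionCount U hs Ls = ∏ (λ i → falling (free U i) (count i (toList hs))) Ls

  -- The count after deciding the first entry, of height a: undefined (only
  -- possible if a = 1) or some admissible y, which then becomes used.
  firstEntryExpansion : ℕ → List (Fin n) → ∀ {m} → Vec ℕ m → List ℕ → ℕ
  firstEntryExpansion a U hs Ls =
    𝟙 (a ≟ 1) * injectionCount U hs Ls + ∑ (λ y → 𝟙 (free? U a y) * injectionCount (y ∷ U) hs Ls) (allFin n)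

  free-other : ∀ U y i → i ≢ suc (τ y) → free (y ∷ U) i ≡ free U i
  free-other U y i i≢ = ∑-ext (allFin n) λ z → 𝟙-⇔ (free? (y ∷ U) i z) (free? U i z)
    (λ (e , z∉yU) → e , z∉yU ∘ there)
    (λ { (e , z∉U) → e , λ { (here refl) → i≢ e ; (there z∈U) → z∉U z∈U } })

  free-same : ∀ U y → y ∉ U → free U (suc (τ y)) ≡ suc (free (y ∷ U) (suc (τ y)))
  free-same U y y∉U = begin
    free U i                                    ≡⟨ ∑-ext (allFin n) split ⟩
    ∑ (λ z → 𝟙 (free? (y ∷ U) i z) + 𝟙 (z ≟F y)) (allFin n) ≡⟨ ∑-+ _ _ (allFin n) ⟩
    free (y ∷ U) i + ∑ (λ z → 𝟙 (z ≟F y)) (allFin n)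
      ≡⟨ cong (free (y ∷ U) i +_) (count-unique (_≟F y) (allFin n) (allFin⁺ n) (λ e e' → trans e (sym e')) (∈-allFin y) refl) ⟩
    free (y ∷ U) i + 1                          ≡⟨ +-comm _ 1 ⟩
    suc (free (y ∷ U) i)                        ∎
    where
    i : ℕ
    i = suc (τ y)
    split : ∀ z → 𝟙 (free? U i z) ≡ 𝟙 (free? (y ∷ U) i z) + 𝟙 (z ≟F y)
    split z = splitBy (z ≟F y)
      where
      splitBy : (d : Dec (z ≡ y)) → 𝟙 (free? U i z) ≡ 𝟙 (free? (y ∷ U) i z) + 𝟙 d
      splitBy (yes refl) = trans (𝟙-yes (free? U i z) (refl , y∉U))
                                 (cong (_+ 1) (sym (𝟙-no (free? (z ∷ U) i z) (λ (_ , z∉) → z∉ (here refl)))))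
      splitBy (no z≢y) = trans (𝟙-⇔ (free? U i z) (free? (y ∷ U) i z)
                                  (λ { (e , z∉U) → e , λ { (here e') → z≢y e' ; (there z∈U) → z∉U z∈U } })
                                  (λ (e , z∉yU) → e , z∉yU ∘ there))
                               (sym (+-identityʳ _))

  -- Adding one point of height 1 to hs (it must stay undefined) does not change the count.
  extend-undefined : (∀ y → τ y ≢ 0) → (Ls : List ℕ) → 1 ∉ Ls → ∀ {m} (hs : Vec ℕ m) U →
    firstEntryExpansion 1 U hs Ls ≡ injectionCount U (1 ∷ hs) Ls
  extend-undefined pos Ls 1∉Ls hs U = begin
    1 * injectionCount U hs Ls + ∑ (λ y → 𝟙 (free? U 1 y) * injectionCount (y ∷ U) hs Ls) (allFin n)
      ≡⟨ cong₂ _+_ (+-identityʳ _) (∑-zero (allFin n) λ {y} _ →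
           cong (_* injectionCount (y ∷ U) hs Ls) (𝟙-no (free? U 1 y) λ (e , _) → pos y (sym (suc-injective e)))) ⟩
    injectionCount U hs Ls + 0 ≡⟨ +-identityʳ _ ⟩
    injectionCount U hs Ls
      ≡⟨ ∏-cong Ls (λ {i} i∈Ls → cong (λ c → falling (free U i) (c + count i (toList hs)))
           (sym (𝟙-no (1 ≟ i) λ { refl → 1∉Ls i∈Ls }))) ⟩
    injectionCount U (1 ∷ hs) Ls ∎

  extend-defined : (Ls : List ℕ) → Unique Ls → 1 ∉ Ls → ∀ {m} (hs : Vec ℕ m) U → ∀ {a} → a ∈ Ls →
    firstEntryExpansion a U hs Ls ≡ injectionCount U (a ∷ hs) Ls
  extend-defined Ls uLs 1∉Ls hs U {a} a∈Ls = begin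
    𝟙 (a ≟ 1) * injectionCount U hs Ls + ∑ (λ y → 𝟙 (free? U a y) * injectionCount (y ∷ U) hs Ls) (allFin n)
      ≡⟨ cong₂ _+_ (cong (_* injectionCount U hs Ls) (𝟙-no (a ≟ 1) λ { refl → 1∉Ls a∈Ls }))
                   (∑-𝟙-const (free? U a) _ rest (allFin n) (λ _ → afterUsing)) ⟩
    free U a * rest                                          ≡⟨ *-assoc (free U a) _ _ ⟨
    free U a * falling (pred (free U a)) (c a) * others    ≡⟨ cong (_* others) (falling-pred (free U a) (c a)) ⟩
    falling (free U a) (suc (c a)) * others
      ≡⟨ cong₂ _*_ (cong (falling (free U a)) (cong (_+ c a) (sym (𝟙-yes (a ≟ a) refl))))
                   (∏-cong (Ls ─ a∈Ls) λ {i} i∈ → cong (λ z → falling (free U i) (z + c i)) (sym (𝟙-no (a ≟ i) (a≢ i∈)))) ⟩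
    factor a * ∏ factor (Ls ─ a∈Ls)                          ≡⟨ ∏-─ factor a∈Ls ⟨
    injectionCount U (a ∷ hs) Ls ∎
    where
    c : ℕ → ℕ
    c i = count i (toList hs)
    factor : ℕ → ℕ
    factor i = falling (free U i) (count i (toList (a ∷ hs)))
    others : ℕ
    others = ∏ (λ i → falling (free U i) (c i)) (Ls ─ a∈Ls)
    rest : ℕ
    rest = falling (pred (free U a)) (c a) * others
    a≢ : ∀ {i} → i ∈ (Ls ─ a∈Ls) → a ≢ i
    a≢ i∈ refl = ∉-─ a∈Ls uLs i∈
    afterUsing : ∀ {y} → Free U a y → injectionCount (y ∷ U) hs Ls ≡ rest
    afterUsing {y} (refl , y∉U) = trans (∏-─ _ a∈Ls)
      (cong₂ _*_ (cong (λ z → falling z (c a)) (cong pred (sym (free-same U y y∉U))))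
                 (∏-cong (Ls ─ a∈Ls) λ {i} i∈ → cong (λ z → falling z (c i)) (free-other U y i λ { refl → a≢ i∈ refl })))

  count-compatible : (∀ y → τ y ≢ 0) → (Ls : List ℕ) → Unique Ls → 1 ∉ Ls →
    ∀ {m} (hs : Vec ℕ m) U → VAll.All (λ a → a ≡ 1 ⊎ a ∈ Ls) hs →
    ∑ (𝟙 ∘ compatible? U hs) (vecsOver targets m) ≡ injectionCount U hs Ls
  count-compatible pos Ls uLs 1∉Ls [] U _ = sym (∏-1 Ls)
  count-compatible pos Ls uLs 1∉Ls {suc m} (a ∷ hs) U (a∈ ∷ hs∈) = begin
    ∑ (𝟙 ∘ compatible? U (a ∷ hs)) (vecsOver targets (suc m))  ≡⟨ ∑-vecsOver targets m _ ⟩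
    ∑ (λ t → ∑ (λ v → 𝟙 (compatible? U (a ∷ hs) (t ∷ v))) (vecsOver targets m)) targets
      ≡⟨ cong₂ _+_ (headWith (a ≟ 1) U) (trans (∑-map _ just (allFin n)) (∑-ext (allFin n) λ y → headWith (free? U a y) (y ∷ U))) ⟩
    firstEntryExpansion a U hs Ls                             ≡⟨ extend a∈ ⟩
    injectionCount U (a ∷ hs) Ls ∎
    where
    headWith : {P : Set} (p : Dec P) (U' : List (Fin n)) →
      ∑ (λ v → 𝟙 (p ×-dec compatible? U' hs v)) (vecsOver targets m) ≡ 𝟙 p * injectionCount U' hs Ls
    headWith p U' = trans (∑-ext (vecsOver targets m) (λ v → 𝟙-× p (compatible? U' hs v)))
      (trans (∑-* (𝟙 p) _ (vecsOver targets m)) (cong (𝟙 p *_) (count-compatible pos Ls uLs 1∉Ls hs U' hs∈)))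
    extend : a ≡ 1 ⊎ a ∈ Ls → firstEntryExpansion a U hs Ls ≡ injectionCount U (a ∷ hs) Ls
    extend (inj₁ refl) = extend-undefined pos Ls 1∉Ls hs U
    extend (inj₂ a∈Ls) = extend-defined Ls uLs 1∉Ls hs U a∈Ls

  compatible-at : ∀ U {m} (hs : Vec ℕ m) v → Compatible U hs v → ∀ j → HeightAt (lookup hs j) (lookup v j) τ
  compatible-at U (a ∷ hs) (nothing ∷ v) (e , _) zero = e
  compatible-at U (a ∷ hs) (just y ∷ v) ((e , _) , _) zero = e
  compatible-at U (a ∷ hs) (nothing ∷ v) (_ , c) (suc j) = compatible-at U hs v c j
  compatible-at U (a ∷ hs) (just y ∷ v) (_ , c) (suc j) = compatible-at (y ∷ U) hs v c j

  compatible-avoids : ∀ U {m} (hs : Vec ℕ m) v → Compatible U hs v → ∀ j y → lookup v j ≡ just y → y ∉ U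
  compatible-avoids U (a ∷ hs) (just z ∷ v) ((_ , z∉U) , _) zero y refl = z∉U
  compatible-avoids U (a ∷ hs) (nothing ∷ v) (_ , c) (suc j) y e = compatible-avoids U hs v c j y e
  compatible-avoids U (a ∷ hs) (just z ∷ v) (_ , c) (suc j) y e y∈U = compatible-avoids (z ∷ U) hs v c j y e (there y∈U)

  compatible-injective : ∀ U {m} (hs : Vec ℕ m) v → Compatible U hs v →
    ∀ i j y → lookup v i ≡ just y → lookup v j ≡ just y → i ≡ j
  compatible-injective U (a ∷ hs) (t ∷ v) c zero zero y _ _ = refl
  compatible-injective U (a ∷ hs) (just z ∷ v) (_ , c) zero (suc j) y refl e' = ⊥-elim (compatible-avoids (z ∷ U) hs v c j z e' (here refl))
  compatible-injective U (a ∷ hs) (just z ∷ v) (_ , c) (suc i) zero y e refl = ⊥-elim (compatible-avoids (z ∷ U) hs v c i z e (here refl))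
  compatible-injective U (a ∷ hs) (nothing ∷ v) (_ , c) (suc i) (suc j) y e e' = cong suc (compatible-injective U hs v c i j y e e')
  compatible-injective U (a ∷ hs) (just z ∷ v) (_ , c) (suc i) (suc j) y e e' = cong suc (compatible-injective (z ∷ U) hs v c i j y e e')

  compatible-intro : ∀ U {m} (hs : Vec ℕ m) v → (∀ j → HeightAt (lookup hs j) (lookup v j) τ) →
    (∀ j y → lookup v j ≡ just y → y ∉ U) →
    (∀ i j y → lookup v i ≡ just y → lookup v j ≡ just y → i ≡ j) → Compatible U hs v
  compatible-intro U [] [] _ _ _ = tt
  compatible-intro U (a ∷ hs) (nothing ∷ v) local avoid inj =
    local zero , compatible-intro U hs v (local ∘ suc) (avoid ∘ suc) (λ i j y e e' → Fin-suc-injective (inj (suc i) (suc j) y e e'))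
  compatible-intro U (a ∷ hs) (just z ∷ v) local avoid inj =
    (local zero , avoid zero z refl) , compatible-intro (z ∷ U) hs v (local ∘ suc) avoid' (λ i j y e e' → Fin-suc-injective (inj (suc i) (suc j) y e e'))
    where
    avoid' : ∀ j y → lookup v j ≡ just y → y ∉ z ∷ U
    avoid' j y e (here refl) with inj zero (suc j) y refl e
    ... | ()
    avoid' j y e (there y∈U) = avoid (suc j) y e y∈U

-- For a height vector l (as a list of heights),
--   levelProduct k l = Π_{i=2}^{k+1} falling (count (i−1) l) (count i l)
-- is the number of partial injections with height function l.  Summed over
-- l ∈ {1..k+1}^n it gives nilpotentCount k n, the number of nilpotent partial
-- injections on n points all of whose paths have at most k+1 points, which
-- satisfies a recursion in k obtained by peeling off the points of top height.
module HeightVectorSums where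

  open import Data.Nat
  open import Data.Nat.Properties
  open import Data.List using (List; []; _∷_; applyUpTo; _∷ʳ_)
  open import Data.List.Properties using (applyUpTo-∷ʳ)
  open import Data.List.Membership.Propositional using (_∈_)
  open import Data.List.Membership.Propositional.Properties using (∈-applyUpTo⁻)
  open import Data.Vec using (Vec; []; _∷_; toList; replicate)
  open import Relation.Nullary using (yes; no)
  open import Relation.Binary.PropositionalEquality
  open import Data.Product using (_,_)
  open import Data.Empty using (⊥-elim)
  open import Function using (_∘_)
  open import Data.Nat.Tactic.RingSolver using (solve-∀)
  open import Defs using (vecsOver)
  open FiniteSums
  open VectorEnumeration
  open Binomials
  open ≡-Reasoning

  count-≢ : ∀ a x l → x ≢ a → count a (x ∷ l) ≡ count a l
  count-≢ a x l x≢a = cong (_+ count a l) (𝟙-no (x ≟ a) x≢a)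

  count-≡ : ∀ a l → count a (a ∷ l) ≡ suc (count a l)
  count-≡ a l = cong (_+ count a l) (𝟙-yes (a ≟ a) refl)

  removeAll : ℕ → List ℕ → List ℕ
  removeAll a [] = []
  removeAll a (x ∷ l) with x ≟ a
  ... | yes _ = removeAll a l
  ... | no _ = x ∷ removeAll a l

  removeAll-≢ : ∀ a x l → x ≢ a → removeAll a (x ∷ l) ≡ x ∷ removeAll a l
  removeAll-≢ a x l x≢a with x ≟ a
  ... | yes x≡a = ⊥-elim (x≢a x≡a)
  ... | no _ = refl

  removeAll-≡ : ∀ a l → removeAll a (a ∷ l) ≡ removeAll a l
  removeAll-≡ a l with a ≟ a
  ... | yes _ = refl
  ... | no a≢a = ⊥-elim (a≢a refl)

  count-removeAll : ∀ i a l → i ≢ a → count i (removeAll a l) ≡ count i l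
  count-removeAll i a [] _ = refl
  count-removeAll i a (x ∷ l) i≢a with x ≟ a
  ... | yes refl = trans (count-removeAll i x l i≢a) (sym (count-≢ i x l (i≢a ∘ sym)))
  ... | no _ = cong (𝟙 (x ≟ i) +_) (count-removeAll i a l i≢a)

  count-replicate : ∀ a m → count a (toList (replicate m a)) ≡ m
  count-replicate a zero = refl
  count-replicate a (suc m) = trans (count-≡ a (toList (replicate m a))) (cong suc (count-replicate a m))

  levels : ℕ → List ℕ
  levels j = applyUpTo suc j

  levelVectors : (j m : ℕ) → List (Vec ℕ m)
  levelVectors j m = vecsOver (levels j) m

  -- Peeling off the top height j+1: summing a function of (the entries below the
  -- top, the number t of top entries) over {1..j+1}^m amounts to choosing the
  -- t positions of the top entries and summing over {1..j}^(m−t) for the rest.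
  peel-top-level : ∀ j m (G : List ℕ → ℕ → ℕ) →
    ∑ (λ h → G (removeAll (suc j) (toList h)) (count (suc j) (toList h))) (levelVectors (suc j) m)
    ≡ ∑< (suc m) (λ t → choose m t * ∑ (λ h → G (toList h) t) (levelVectors j (m ∸ t)))
  peel-top-level j zero G = sym (trans (+-identityʳ _) (*-identityˡ _))
  peel-top-level j (suc m) G = begin
    ∑ (λ h → G (removeAll (suc j) (toList h)) (count (suc j) (toList h))) (levelVectors (suc j) (suc m))
      ≡⟨ ∑-vecsOver (levels (suc j)) m _ ⟩
    ∑ (λ x → ∑ (F x) (levelVectors (suc j) m)) (levels (suc j))
      ≡⟨ cong (∑ (λ x → ∑ (F x) (levelVectors (suc j) m))) (applyUpTo-∷ʳ suc j) ⟨
    ∑ (λ x → ∑ (F x) (levelVectors (suc j) m)) (levels j ∷ʳ suc j)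
      ≡⟨ ∑-++ _ (levels j) (suc j ∷ []) ⟩
    ∑ (λ x → ∑ (F x) (levelVectors (suc j) m)) (levels j) + (∑ (F (suc j)) (levelVectors (suc j) m) + 0)
      ≡⟨ cong₂ _+_ lowerHead (trans (+-identityʳ _) topHead) ⟩
    ∑ (λ x → ∑< (suc m) (λ t → choose m t * Wx x (m ∸ t) t)) (levels j) + ∑< (suc m) (λ t → choose m t * W (m ∸ t) (suc t))
      ≡⟨ cong (_+ ∑< (suc m) (λ t → choose m t * W (m ∸ t) (suc t))) gatherHeads ⟩
    ∑< (suc m) (λ t → choose m t * W (suc (m ∸ t)) t) + ∑< (suc m) (λ t → choose m t * W (m ∸ t) (suc t))
      ≡⟨ pascal-convolution m W ⟩
    ∑< (suc (suc m)) (λ t → choose (suc m) t * W (suc m ∸ t) t) ∎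
    where
    F : ℕ → Vec ℕ m → ℕ
    F x h = G (removeAll (suc j) (x ∷ toList h)) (count (suc j) (x ∷ toList h))
    W : ℕ → ℕ → ℕ
    W m′ t = ∑ (λ h → G (toList h) t) (levelVectors j m′)
    Wx : ℕ → ℕ → ℕ → ℕ
    Wx x m′ t = ∑ (λ h → G (x ∷ toList h) t) (levelVectors j m′)
    lowerHead : ∑ (λ x → ∑ (F x) (levelVectors (suc j) m)) (levels j)
              ≡ ∑ (λ x → ∑< (suc m) (λ t → choose m t * Wx x (m ∸ t) t)) (levels j)
    lowerHead = ∑-cong (levels j) λ {x} x∈ → trans (∑-ext (levelVectors (suc j) m) (keep x∈))
                                                   (peel-top-level j m (λ l t → G (x ∷ l) t))
      where
      keep : ∀ {x} → x ∈ levels j → ∀ h → F x h ≡ G (x ∷ removeAll (suc j) (toList h)) (count (suc j) (toList h))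
      keep x∈ h with ∈-applyUpTo⁻ suc x∈
      ... | i , i<j , refl = cong₂ G (removeAll-≢ (suc j) (suc i) (toList h) i≢j) (count-≢ (suc j) (suc i) (toList h) i≢j)
        where
        i≢j : suc i ≢ suc j
        i≢j e = <⇒≢ i<j (suc-injective e)
    topHead : ∑ (F (suc j)) (levelVectors (suc j) m) ≡ ∑< (suc m) (λ t → choose m t * W (m ∸ t) (suc t))
    topHead = trans (∑-ext (levelVectors (suc j) m) (λ h → cong₂ G (removeAll-≡ (suc j) (toList h)) (count-≡ (suc j) (toList h))))
                    (peel-top-level j m (λ l t → G l (suc t)))
    gatherHeads : ∑ (λ x → ∑< (suc m) (λ t → choose m t * Wx x (m ∸ t) t)) (levels j)
                ≡ ∑< (suc m) (λ t → choose m t * W (suc (m ∸ t)) t)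
    gatherHeads = trans (∑-∑< (suc m) (λ x t → choose m t * Wx x (m ∸ t) t) (levels j))
      (∑<-cong (suc m) λ t _ → trans (∑-* (choose m t) (λ x → Wx x (m ∸ t) t) (levels j))
                                     (cong (choose m t *_) (sym (∑-vecsOver (levels j) (m ∸ t) (λ h → G (toList h) t)))))

  levelProduct : ℕ → List ℕ → ℕ
  levelProduct zero l = 1
  levelProduct (suc k) l = levelProduct k l * falling (count (suc k) l) (count (suc (suc k)) l)

  levelProduct-cong : ∀ k l l′ → (∀ i → i ≤ suc k → count i l ≡ count i l′) → levelProduct k l ≡ levelProduct k l′
  levelProduct-cong zero l l′ e = refl
  levelProduct-cong (suc k) l l′ e =
    cong₂ _*_ (levelProduct-cong k l l′ (λ i i≤ → e i (m≤n⇒m≤1+n i≤)))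
              (cong₂ falling (e (suc k) (n≤1+n _)) (e (suc (suc k)) ≤-refl))

  levelProduct-as-∏ : ∀ k l → ∏ (λ i → falling (count (pred i) l) (count i l)) (applyUpTo (suc ∘ suc) k) ≡ levelProduct k l
  levelProduct-as-∏ zero l = refl
  levelProduct-as-∏ (suc k) l = begin
    ∏ factor (applyUpTo (suc ∘ suc) (suc k))            ≡⟨ cong (∏ factor) (applyUpTo-∷ʳ (suc ∘ suc) k) ⟨
    ∏ factor (applyUpTo (suc ∘ suc) k ∷ʳ suc (suc k))   ≡⟨ ∏-++ factor (applyUpTo (suc ∘ suc) k) _ ⟩
    ∏ factor (applyUpTo (suc ∘ suc) k) * (factor (suc (suc k)) * 1)
      ≡⟨ cong₂ _*_ (levelProduct-as-∏ k l) (*-identityʳ _) ⟩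
    levelProduct (suc k) l ∎
    where
    factor : ℕ → ℕ
    factor i = falling (count (pred i) l) (count i l)

  -- nilpotentCount k n: choose the t tops of the paths with k+2 points, then the
  -- (k+1)t further points of those paths in order, then recurse on the rest.
  nilpotentCount : ℕ → ℕ → ℕ
  nilpotentCount zero m = 1
  nilpotentCount (suc k) n = ∑< (suc n) (λ t → choose n t * falling (n ∸ t) (suc k * t) * nilpotentCount k (n ∸ t ∸ suc k * t))

  nilpotentCount-range : ∀ k m d →
    ∑< (suc m + d) (λ s → choose m s * falling (m ∸ s) (suc k * s) * nilpotentCount k (m ∸ s ∸ suc k * s))
    ≡ nilpotentCount (suc k) m
  nilpotentCount-range k m d = begin
    ∑< (suc m + d) R                                   ≡⟨ ∑<-split (suc m) d R ⟩
    nilpotentCount (suc k) m + ∑< d (λ s → R (suc m + s))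
      ≡⟨ cong (nilpotentCount (suc k) m +_) (∑<-zero d λ s _ →
           cong (λ z → z * falling (m ∸ (suc m + s)) (suc k * (suc m + s)) * nilpotentCount k (m ∸ (suc m + s) ∸ suc k * (suc m + s)))
                (choose-zero m (suc m + s) (s≤s (m≤m+n m s)))) ⟩
    nilpotentCount (suc k) m + 0                       ≡⟨ +-identityʳ _ ⟩
    nilpotentCount (suc k) m ∎
    where
    R : ℕ → ℕ
    R s = choose m s * falling (m ∸ s) (suc k * s) * nilpotentCount k (m ∸ s ∸ suc k * s)

  -- The summand of the weighted recursion: t points of level k+1 above which u
  -- further points are placed injectively.
  weightedTerm : ℕ → ℕ → ℕ → ℕ → ℕ
  weightedTerm k n u t = choose n t * (falling t u * (falling (n ∸ t) (suc k * t) * nilpotentCount k (n ∸ t ∸ suc k * t)))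

  weightedTerm-below : ∀ k n u t → t < u → weightedTerm k n u t ≡ 0
  weightedTerm-below k n u t t<u =
    trans (cong (λ z → choose n t * (z * _)) (falling-zero t u t<u)) (*-zeroʳ (choose n t))

  -- The term t = u + s, regrouped around the (k+2)u points occupied by u
  -- additional paths: it is a summand of nilpotentCount (k+1) (n − (k+2)u).
  shifted-term : ∀ k n u s → let n′ = n ∸ suc (suc k) * u in
    weightedTerm k n u (u + s)
    ≡ falling n (suc (suc k) * u) * (choose n′ s * falling (n′ ∸ s) (suc k * s) * nilpotentCount k (n′ ∸ s ∸ suc k * s))
  shifted-term k n u s = begin
    choose n (u + s) * (falling (u + s) u * (falling (n ∸ (u + s)) (sk * (u + s)) * N (n ∸ (u + s) ∸ sk * (u + s))))
      ≡⟨ cong (λ z → choose n (u + s) * (falling (u + s) u * (falling (n ∸ (u + s)) z * N (n ∸ (u + s) ∸ sk * (u + s)))))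
              (*-distribˡ-+ sk u s) ⟩
    choose n (u + s) * (falling (u + s) u * (falling (n ∸ (u + s)) (sk * u + sk * s) * N (n ∸ (u + s) ∸ sk * (u + s))))
      ≡⟨ *-reassoc (choose n (u + s)) (falling (u + s) u) _ _ ⟩
    choose n (u + s) * falling (u + s) u * falling (n ∸ (u + s)) (sk * u + sk * s) * N (n ∸ (u + s) ∸ sk * (u + s))
      ≡⟨ cong₂ _*_ (choose-falling-regroup n u s (sk * u) (sk * s)) (cong N remaining) ⟩
    falling n (u + sk * u) * (choose n′ s * falling (n′ ∸ s) (sk * s)) * N (n′ ∸ s ∸ sk * s)
      ≡⟨ *-assoc (falling n (u + sk * u)) _ _ ⟩
    falling n (suc (suc k) * u) * (choose n′ s * falling (n′ ∸ s) (sk * s) * N (n′ ∸ s ∸ sk * s)) ∎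
    where
    sk : ℕ
    sk = suc k
    n′ : ℕ
    n′ = n ∸ suc (suc k) * u
    N : ℕ → ℕ
    N = nilpotentCount k
    *-reassoc : ∀ a b c d → a * (b * (c * d)) ≡ a * b * c * d
    *-reassoc = solve-∀
    -- Both sides remove the same (k+2)(u+s) points.
    remaining : n ∸ (u + s) ∸ sk * (u + s) ≡ n′ ∸ s ∸ sk * s
    remaining = begin
      n ∸ (u + s) ∸ sk * (u + s)          ≡⟨ ∸-+-assoc n (u + s) (sk * (u + s)) ⟩
      n ∸ ((u + s) + sk * (u + s))        ≡⟨ cong (n ∸_) (regroup u s) ⟩
      n ∸ (suc (suc k) * u + (s + sk * s)) ≡⟨ ∸-+-assoc n (suc (suc k) * u) (s + sk * s) ⟨
      n′ ∸ (s + sk * s)                    ≡⟨ ∸-+-assoc n′ s (sk * s) ⟨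
      n′ ∸ s ∸ sk * s                      ∎
      where
      regroup : ∀ u s → (u + s) + suc k * (u + s) ≡ suc (suc k) * u + (s + suc k * s)
      regroup = solve-∀

  -- Σ_t weightedTerm k n u t = falling n ((k+2)u) · nilpotentCount (k+1) (n − (k+2)u):
  -- only t ≥ u contributes, and t = u + s gives the recursion for nilpotentCount (k+1).
  weighted-nilpotent-sum : ∀ k n u →
    ∑< (suc n) (weightedTerm k n u) ≡ falling n (suc (suc k) * u) * nilpotentCount (suc k) (n ∸ suc (suc k) * u)
  weighted-nilpotent-sum k n u with u ≤? n
  ... | no u≰n = begin
    ∑< (suc n) (weightedTerm k n u)
      ≡⟨ ∑<-zero (suc n) (λ t t≤n → weightedTerm-below k n u t (<-≤-trans t≤n (≰⇒> u≰n))) ⟩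
    0 ≡⟨ cong (_* nilpotentCount (suc k) (n ∸ suc (suc k) * u)) (falling-zero n (suc (suc k) * u) (<-≤-trans (≰⇒> u≰n) (m≤m+n u _))) ⟨
    falling n (suc (suc k) * u) * nilpotentCount (suc k) (n ∸ suc (suc k) * u) ∎
  ... | yes u≤n = begin
    ∑< (suc n) T                                        ≡⟨ cong (λ z → ∑< z T) u+rest ⟨
    ∑< (u + suc (n ∸ u)) T                              ≡⟨ ∑<-split u (suc (n ∸ u)) T ⟩
    ∑< u T + ∑< (suc (n ∸ u)) (λ s → T (u + s))
      ≡⟨ cong₂ _+_ (∑<-zero u (weightedTerm-below k n u)) (∑<-cong (suc (n ∸ u)) (λ s _ → shifted-term k n u s)) ⟩
    0 + ∑< (suc (n ∸ u)) (λ s → falling n (suc (suc k) * u) * R s) ≡⟨ ∑<-* (suc (n ∸ u)) (falling n (suc (suc k) * u)) R ⟩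
    falling n (suc (suc k) * u) * ∑< (suc (n ∸ u)) R   ≡⟨ cong (λ z → falling n (suc (suc k) * u) * ∑< (suc z) R) n′+d ⟨
    falling n (suc (suc k) * u) * ∑< (suc n′ + d) R    ≡⟨ cong (falling n (suc (suc k) * u) *_) (nilpotentCount-range k n′ d) ⟩
    falling n (suc (suc k) * u) * nilpotentCount (suc k) n′ ∎
    where
    T : ℕ → ℕ
    T = weightedTerm k n u
    n′ : ℕ
    n′ = n ∸ suc (suc k) * u
    R : ℕ → ℕ
    R s = choose n′ s * falling (n′ ∸ s) (suc k * s) * nilpotentCount k (n′ ∸ s ∸ suc k * s)
    u+rest : u + suc (n ∸ u) ≡ suc n
    u+rest = trans (+-suc u (n ∸ u)) (cong suc (m+[n∸m]≡n u≤n))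
    d : ℕ
    d = (n ∸ u) ∸ n′
    n′+d : n′ + d ≡ n ∸ u
    n′+d = m+[n∸m]≡n (∸-monoʳ-≤ n (m≤m+n u (suc k * u)))

  -- Σ_{h ∈ {1..k+1}^m} levelProduct k h · falling (count (k+1) h) u
  --   = falling m ((k+1)u) · nilpotentCount k (m − (k+1)u):
  -- the extra factor counts u further paths placed on top of the level-(k+1) points.
  weighted-level-sum : ∀ k m u →
    ∑ (λ h → levelProduct k (toList h) * falling (count (suc k) (toList h)) u) (levelVectors (suc k) m)
    ≡ falling m (suc k * u) * nilpotentCount k (m ∸ suc k * u)
  weighted-level-sum zero m u = begin
    ∑ (λ h → levelProduct 0 (toList h) * falling (count 1 (toList h)) u) (vecsOver (1 ∷ []) m)
                                  ≡⟨ ∑-vecsOver-single 1 m _ ⟩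
    falling (count 1 (toList (replicate m 1))) u + 0 ≡⟨ cong (λ z → falling z u + 0) (count-replicate 1 m) ⟩
    falling m u + 0               ≡⟨ +-identityʳ _ ⟩
    falling m u                   ≡⟨ cong (falling m) (+-identityʳ u) ⟨
    falling m (u + 0)             ≡⟨ *-identityʳ _ ⟨
    falling m (1 * u) * 1         ∎
  weighted-level-sum (suc k) m u = begin
    ∑ (λ h → levelProduct (suc k) (toList h) * falling (count top (toList h)) u) (levelVectors top m)
      ≡⟨ ∑-ext (levelVectors top m) split-top ⟩
    ∑ (λ h → G (removeAll top (toList h)) (count top (toList h))) (levelVectors top m)
      ≡⟨ peel-top-level (suc k) m G ⟩
    ∑< (suc m) (λ t → choose m t * ∑ (λ h → G (toList h) t) (levelVectors (suc k) (m ∸ t)))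
      ≡⟨ ∑<-cong (suc m) (λ t _ → cong (choose m t *_) (lower t)) ⟩
    ∑< (suc m) (weightedTerm k m u)                     ≡⟨ weighted-nilpotent-sum k m u ⟩
    falling m (suc (suc k) * u) * nilpotentCount (suc k) (m ∸ suc (suc k) * u) ∎
    where
    top : ℕ
    top = suc (suc k)
    G : List ℕ → ℕ → ℕ
    G l t = levelProduct k l * falling (count (suc k) l) t * falling t u
    below-top : ∀ {i} → i ≤ suc k → i ≢ top
    below-top i≤ refl = 1+n≰n i≤
    split-top : ∀ h → levelProduct (suc k) (toList h) * falling (count top (toList h)) u
                    ≡ G (removeAll top (toList h)) (count top (toList h))
    split-top h = cong₂ (λ a b → a * b * falling (count top (toList h)) u)
      (levelProduct-cong k (toList h) _ (λ i i≤ → sym (count-removeAll i top (toList h) (below-top i≤))))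
      (cong (λ z → falling z (count top (toList h))) (sym (count-removeAll (suc k) top (toList h) (below-top ≤-refl))))
    lower : ∀ t → ∑ (λ h → G (toList h) t) (levelVectors (suc k) (m ∸ t))
                ≡ falling t u * (falling (m ∸ t) (suc k * t) * nilpotentCount k (m ∸ t ∸ suc k * t))
    lower t = trans (∑-ext (levelVectors (suc k) (m ∸ t)) (λ h → *-comm (levelProduct k (toList h) * falling (count (suc k) (toList h)) t) (falling t u)))
      (trans (∑-* (falling t u) _ (levelVectors (suc k) (m ∸ t))) (cong (falling t u *_) (weighted-level-sum k (m ∸ t) t)))

  level-sum : ∀ k m → ∑ (levelProduct k ∘ toList) (levelVectors (suc k) m) ≡ nilpotentCount k m
  level-sum k m = begin
    ∑ (levelProduct k ∘ toList) (levelVectors (suc k) m)    ≡⟨ ∑-ext (levelVectors (suc k) m) (λ h → *-identityʳ _) ⟨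
    ∑ (λ h → levelProduct k (toList h) * falling (count (suc k) (toList h)) 0) (levelVectors (suc k) m)
                                                             ≡⟨ weighted-level-sum k m 0 ⟩
    falling m (suc k * 0) * nilpotentCount k (m ∸ suc k * 0) ≡⟨ cong (λ z → falling m z * nilpotentCount k (m ∸ z)) (*-zeroʳ (suc k)) ⟩
    1 * nilpotentCount k m                                   ≡⟨ *-identityˡ _ ⟩
    nilpotentCount k m                                       ∎

-- A table v is a nilpotent
-- partial injection (α^K = ∅, K = k+1) iff it is compatible with exactly one
-- height vector h ∈ {1..K}^n, namely its height function.  Exchanging the sums
-- over tables and height vectors and counting the compatible tables of each h
-- (CompatibleMaps) gives  r_K(∅) = Σ_h levelProduct k h  (HeightVectorSums).
module CountByHeights (k n : ℕ) where

  open import Data.Nat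
  open import Data.Nat.Properties
  open import Data.Maybe using (Maybe; nothing; just)
  open import Data.List using (List; []; _∷_; map; allFin; applyUpTo)
  open import Data.List.Membership.Propositional using (_∈_; _∉_)
  open import Data.List.Membership.Propositional.Properties using (∈-applyUpTo⁺; ∈-applyUpTo⁻)
  open import Data.List.Relation.Unary.Any using (here; there)
  open import Data.List.Relation.Unary.Unique.Propositional using (Unique)
  open import Data.List.Relation.Unary.Unique.Propositional.Properties using (applyUpTo⁺₁)
  open import Data.Vec using (Vec; lookup; toList; tabulate)
  open import Data.Vec.Properties using (lookup∘tabulate; tabulate∘lookup; tabulate-cong)
  open import Data.Vec.Relation.Unary.All.Properties using (lookup⁺; lookup⁻)
  open import Relation.Nullary using (Dec; yes; no; _×-dec_)
  open import Relation.Binary.PropositionalEquality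
  open import Data.Product using (_×_; _,_; proj₁; proj₂)
  open import Data.Sum using (_⊎_; inj₁; inj₂)
  open import Function using (_∘_)
  open FiniteSums
  open VectorEnumeration
  open Binomials
  open Heights
  open HeightVectorSums
  open ≡-Reasoning

  K : ℕ
  K = suc k

  upperLevels : List ℕ
  upperLevels = applyUpTo (suc ∘ suc) k

  heightVectors : List (Vec ℕ n)
  heightVectors = levelVectors K n

  tables : List (Vec (Maybe (Fin n)) n)
  tables = vecsOver (nothing ∷ map just (allFin n)) n

  NilpotentInjection : Vec (Maybe (Fin n)) n → Set
  NilpotentInjection v = IsPartialInjection (lookup v) × (lookup v ^ₚ K) ≈ₚ emptyₚ

  nilpotentInjection? : ∀ v → Dec (NilpotentInjection v)
  nilpotentInjection? v = isPartialInjection? (lookup v) ×-dec ≈ₚ? (lookup v ^ₚ K) emptyₚ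

  r-as-table-sum : r {n} K emptyₚ ≡ ∑ (𝟙 ∘ nilpotentInjection?) tables
  r-as-table-sum = trans (length-filter _ (allPMaps n)) (∑-map _ lookup tables)

  levels-unique : Unique (levels K)
  levels-unique = applyUpTo⁺₁ suc K (λ i<j _ e → <⇒≢ i<j (suc-injective e))

  levels-range : ∀ {a} → a ∈ levels K → 1 ≤ a × a ≤ K
  levels-range a∈ with ∈-applyUpTo⁻ suc a∈
  ... | i , i<K , refl = s≤s z≤n , i<K

  upperLevels-unique : Unique upperLevels
  upperLevels-unique = applyUpTo⁺₁ (suc ∘ suc) k (λ i<j _ e → <⇒≢ i<j (suc-injective (suc-injective e)))

  1∉upperLevels : 1 ∉ upperLevels
  1∉upperLevels 1∈ with ∈-applyUpTo⁻ (suc ∘ suc) 1∈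
  ... | _ , _ , ()

  entries∈levels : ∀ {h} → h ∈ heightVectors → ∀ x → lookup h x ∈ levels K
  entries∈levels {h} h∈ = lookup⁺ (vecsOver-∈ (levels K) h h∈)

  Compatible : Vec ℕ n → Vec (Maybe (Fin n)) n → Set
  Compatible h v = CompatibleMaps.Compatible (lookup h) [] h v

  compatible? : ∀ h v → Dec (Compatible h v)
  compatible? h v = CompatibleMaps.compatible? (lookup h) [] h v

  compatible⇒height : ∀ h v → Compatible h v → IsHeight (lookup v) (lookup h) × IsPartialInjection (lookup v)
  compatible⇒height h v c = CompatibleMaps.compatible-at (lookup h) [] h v c
                          , CompatibleMaps.compatible-injective (lookup h) [] h v c

  height⇒compatible : ∀ h v → IsHeight (lookup v) (lookup h) → IsPartialInjection (lookup v) → Compatible h v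
  height⇒compatible h v isH inj = CompatibleMaps.compatible-intro (lookup h) [] h v isH (λ _ _ _ ()) inj

  count-height-vectors : ∀ v → 𝟙 (nilpotentInjection? v) ≡ ∑ (λ h → 𝟙 (compatible? h v)) heightVectors
  count-height-vectors v with nilpotentInjection? v
  ... | yes (inj , nil) = sym (count-unique (λ h → compatible? h v) heightVectors
                                (unique-vecsOver (levels K) n levels-unique) sameHeights h₀∈ (height⇒compatible h₀ v isH₀ inj))
    where
    α : PMap n
    α = lookup v
    h₀ : Vec ℕ n
    h₀ = tabulate (height α K)
    isH₀ : IsHeight α (lookup h₀)
    isH₀ = IsHeight-resp α (height α K) (lookup h₀) (λ x → sym (lookup∘tabulate (height α K) x)) (nilpotent⇒height α k nil)
    inRange : ∀ x → height α K x ∈ levels K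
    inRange x with height α K x | height-pos α K x | nilpotent⇒height-≤ α K nil x
    ... | suc f | _ | f<K = ∈-applyUpTo⁺ suc f<K
    h₀∈ : h₀ ∈ heightVectors
    h₀∈ = ∈-vecsOver (levels K) h₀ (lookup⁻ λ x → subst (_∈ levels K) (sym (lookup∘tabulate (height α K) x)) (inRange x))
    sameHeights : ∀ {a b} → Compatible a v → Compatible b v → a ≡ b
    sameHeights {a} {b} ca cb = begin
      a                   ≡⟨ tabulate∘lookup a ⟨
      tabulate (lookup a) ≡⟨ tabulate-cong (height-unique α (lookup a) (lookup b) (proj₁ (compatible⇒height a v ca)) (proj₁ (compatible⇒height b v cb))) ⟩
      tabulate (lookup b) ≡⟨ tabulate∘lookup b ⟩
      b                   ∎
  ... | no ¬nilInj = sym (∑-zero heightVectors λ {h} h∈ → 𝟙-no (compatible? h v) λ c →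
          let isH , inj = compatible⇒height h v c in
          ¬nilInj (inj , bounded-height⇒nilpotent (lookup v) K (lookup h) isH (λ x → proj₂ (levels-range (entries∈levels h∈ x)))))

  count-tables : ∀ {h} → h ∈ heightVectors → ∑ (𝟙 ∘ compatible? h) tables ≡ levelProduct k (toList h)
  count-tables {h} h∈ = begin
    ∑ (𝟙 ∘ compatible? h) tables
      ≡⟨ CompatibleMaps.count-compatible (lookup h) positive upperLevels upperLevels-unique 1∉upperLevels h []
           (lookup⁻ (λ x → bottomOrUpper (entries∈levels h∈ x))) ⟩
    CompatibleMaps.injectionCount (lookup h) [] h upperLevels
      ≡⟨ ∏-cong upperLevels levelFactor ⟩
    ∏ (λ i → falling (count (pred i) (toList h)) (count i (toList h))) upperLevels
      ≡⟨ levelProduct-as-∏ k (toList h) ⟩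
    levelProduct k (toList h) ∎
    where
    positive : ∀ y → lookup h y ≢ 0
    positive y e = <⇒≢ (proj₁ (levels-range (entries∈levels h∈ y))) (sym e)
    bottomOrUpper : ∀ {a} → a ∈ levels K → a ≡ 1 ⊎ a ∈ upperLevels
    bottomOrUpper (here e) = inj₁ e
    bottomOrUpper (there a∈) = inj₂ a∈
    free-level : ∀ j → CompatibleMaps.free (lookup h) [] (suc j) ≡ count j (toList h)
    free-level j = trans (∑-ext (allFin n) λ y →
                           𝟙-⇔ (CompatibleMaps.free? (lookup h) [] (suc j) y) (lookup h y ≟ j)
                               (λ (e , _) → sym (suc-injective e)) (λ e → cong suc (sym e) , λ ()))
                         (∑-allFin-lookup h (λ a → 𝟙 (a ≟ j)))
    levelFactor : ∀ {i} → i ∈ upperLevels →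
      falling (CompatibleMaps.free (lookup h) [] i) (count i (toList h)) ≡ falling (count (pred i) (toList h)) (count i (toList h))
    levelFactor i∈ with ∈-applyUpTo⁻ (suc ∘ suc) i∈
    ... | j , _ , refl = cong (λ z → falling z (count (suc (suc j)) (toList h))) (free-level (suc j))

  r-nilpotentCount : r {n} K emptyₚ ≡ nilpotentCount k n
  r-nilpotentCount = begin
    r {n} K emptyₚ                                                     ≡⟨ r-as-table-sum ⟩
    ∑ (𝟙 ∘ nilpotentInjection?) tables                                 ≡⟨ ∑-ext tables count-height-vectors ⟩
    ∑ (λ v → ∑ (λ h → 𝟙 (compatible? h v)) heightVectors) tables        ≡⟨ ∑-swap _ tables heightVectors ⟩
    ∑ (λ h → ∑ (𝟙 ∘ compatible? h) tables) heightVectors                ≡⟨ ∑-cong heightVectors count-tables ⟩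
    ∑ (levelProduct k ∘ toList) heightVectors                          ≡⟨ level-sum k n ⟩
    nilpotentCount k n                                                 ∎

module FrequencyProducts where

  open import Data.Nat
  open import Data.Nat.Properties
  open import Data.List using (List; []; _∷_; map; filter; length; deduplicate; replicate; _++_)
  open import Data.List.Properties using (filter-accept; filter-reject; filter-all; filter-idem)
  open import Data.List.Membership.Propositional using (_∈_; _∉_)
  open import Data.List.Membership.Propositional.Properties using (∈-deduplicate⁻)
  open import Data.List.Relation.Unary.Any using (here; there)
  open import Data.List.Relation.Unary.All using (All; []; _∷_)
  open import Data.Nat.ListAction using (product)
  open import Relation.Nullary using (¬_; ¬?)
  open import Relation.Binary.PropositionalEquality
  open import Function using (_∘_)
  open FiniteSums using (∏; ∏-cong)

  product-map : (f : ℕ → ℕ) (xs : List ℕ) → product (map f xs) ≡ ∏ f xs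
  product-map f [] = refl
  product-map f (x ∷ xs) = cong (f x *_) (product-map f xs)

  freq-replicate-same : ∀ a t μ → freq a (replicate t a ++ μ) ≡ t + freq a μ
  freq-replicate-same a zero μ = refl
  freq-replicate-same a (suc t) μ =
    trans (cong length (filter-accept (a ≟_) refl)) (cong suc (freq-replicate-same a t μ))

  freq-replicate-other : ∀ b a t μ → b ≢ a → freq b (replicate t a ++ μ) ≡ freq b μ
  freq-replicate-other b a zero μ b≢a = refl
  freq-replicate-other b a (suc t) μ b≢a =
    trans (cong length (filter-reject (b ≟_) b≢a)) (freq-replicate-other b a t μ b≢a)

  freq-∉ : ∀ a μ → a ∉ μ → freq a μ ≡ 0
  freq-∉ a [] _ = refl
  freq-∉ a (x ∷ μ) a∉ = trans (cong length (filter-reject (a ≟_) (a∉ ∘ here))) (freq-∉ a μ (a∉ ∘ there))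

  deduplicate-replicate : ∀ a t μ → a ∉ μ →
    filter (¬? ∘ (a ≟_)) (deduplicate _≟_ (replicate t a ++ μ)) ≡ deduplicate _≟_ μ
  deduplicate-replicate a zero μ a∉μ = filter-all (¬? ∘ (a ≟_)) (others (deduplicate _≟_ μ) (∈-deduplicate⁻ _≟_ μ))
    where
    others : ∀ xs → (∀ {z} → z ∈ xs → z ∈ μ) → All (λ z → ¬ (a ≡ z)) xs
    others [] _ = []
    others (x ∷ xs) ⊆μ = (λ { refl → a∉μ (⊆μ (here refl)) }) ∷ others xs (⊆μ ∘ there)
  deduplicate-replicate a (suc t) μ a∉μ =
    trans (filter-reject (¬? ∘ (a ≟_)) (λ a≢a → a≢a refl))
          (trans (filter-idem (¬? ∘ (a ≟_)) (deduplicate _≟_ (replicate t a ++ μ))) (deduplicate-replicate a t μ a∉μ))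

  freqFactProd-replicate : ∀ a t μ → a ∉ μ → freqFactProd (replicate t a ++ μ) ≡ t ! * freqFactProd μ
  freqFactProd-replicate a zero μ a∉μ = sym (+-identityʳ _)
  freqFactProd-replicate a (suc t) μ a∉μ = begin
    freqFactProd (replicate (suc t) a ++ μ)
      ≡⟨ cong (λ ds → product (map (λ b → freq b λs !) (a ∷ ds))) (deduplicate-replicate a t μ a∉μ) ⟩
    freq a λs ! * product (map (λ b → freq b λs !) (deduplicate _≟_ μ))
      ≡⟨ cong₂ _*_ (cong _! (trans (freq-replicate-same a (suc t) μ) (trans (cong (suc t +_) (freq-∉ a μ a∉μ)) (+-identityʳ _))))
                   (trans (product-map _ (deduplicate _≟_ μ)) (trans (∏-cong (deduplicate _≟_ μ) unchanged) (sym (product-map _ (deduplicate _≟_ μ))))) ⟩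
    suc t ! * freqFactProd μ ∎
    where
    open ≡-Reasoning
    λs : List ℕ
    λs = replicate (suc t) a ++ μ
    unchanged : ∀ {b} → b ∈ deduplicate _≟_ μ → freq b λs ! ≡ freq b μ !
    unchanged b∈ = cong _! (freq-replicate-other _ a (suc t) μ λ { refl → a∉μ (∈-deduplicate⁻ _≟_ μ b∈) })

-- An explicit enumeration of the partitions of N with parts ≤ k+1 (as
-- non-increasing lists): all ones for k = 0; otherwise t copies of the top part
-- k+2 followed by a partition of N − (k+2)t with parts ≤ k+1.  It lists every
-- such partition exactly once.
module BoundedPartitions where

  open import Data.Nat
  open import Data.Nat.Properties
  open import Data.List using (List; []; _∷_; map; replicate; _++_; concatMap; upTo)
  open import Data.List.Properties using (++-cancelˡ)
  open import Data.List.Membership.Propositional using (_∈_; _∉_)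
  open import Data.List.Membership.Propositional.Properties using (∈-map⁺; ∈-map⁻; ∈-upTo⁺)
  open import Data.List.Relation.Unary.Any using (here)
  open import Data.List.Relation.Unary.All as All using (All; []; _∷_)
  open import Data.List.Relation.Unary.All.Properties using (++⁺; ++⁻ʳ; replicate⁺)
  open import Data.List.Relation.Unary.Linked as Linked using (Linked; []; [-]; _∷_)
  open import Data.List.Relation.Unary.Linked.Properties using (Linked⇒All)
  open import Data.List.Relation.Unary.Unique.Propositional using (Unique)
  open import Data.List.Relation.Unary.Unique.Propositional.Properties using (map⁺; upTo⁺)
  open import Data.List.Relation.Unary.AllPairs using ([]; _∷_)
  open import Data.Nat.ListAction using (sum)
  open import Data.Nat.ListAction.Properties using (sum-++)
  open import Relation.Nullary using (Dec; yes; no)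
  open import Relation.Binary.PropositionalEquality
  open import Data.Product using (Σ; _×_; _,_; proj₂)
  open import Data.Empty using (⊥-elim)
  open VectorEnumeration using (∈-concatMap-intro; ∈-concatMap-elim; unique-concatMap)
  open FrequencyProducts using (freq-replicate-same; freq-∉)

  BoundedPartition : ℕ → ℕ → List ℕ → Set
  BoundedPartition N K λs = IsPartitionOf N λs × MaxAtMost K λs

  partitions : ℕ → ℕ → List (List ℕ)
  withTop : ℕ → ℕ → ℕ → List (List ℕ)
  withTopIf : ∀ k N t → Dec (suc (suc k) * t ≤ N) → List (List ℕ)
  partitions zero N = replicate N 1 ∷ []
  partitions (suc k) N = concatMap (withTop k N) (upTo (suc N))
  withTop k N t = withTopIf k N t (suc (suc k) * t ≤? N)
  withTopIf k N t (yes _) = map (replicate t (suc (suc k)) ++_) (partitions k (N ∸ suc (suc k) * t))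
  withTopIf k N t (no _) = []

  sum-replicate : ∀ t a → sum (replicate t a) ≡ t * a
  sum-replicate zero a = refl
  sum-replicate (suc t) a = cong (a +_) (sum-replicate t a)

  linked-replicate : ∀ t a μ → Linked _≥_ μ → All (_≤ a) μ → Linked _≥_ (replicate t a ++ μ)
  linked-replicate zero a μ l _ = l
  linked-replicate (suc zero) a [] l _ = [-]
  linked-replicate (suc zero) a (y ∷ μ) l (y≤a ∷ _) = y≤a ∷ l
  linked-replicate (suc (suc t)) a μ l μ≤a = ≤-refl ∷ linked-replicate (suc t) a μ l μ≤a

  linked-below-head : ∀ x μ → Linked _≥_ (x ∷ μ) → All (_≤ x) μ
  linked-below-head x μ l with Linked⇒All (λ a b → ≤-trans b a) ≤-refl l
  ... | _ ∷ μ≤x = μ≤x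

  all-ones : ∀ λs → All (_≥ 1) λs → All (_≤ 1) λs → λs ≡ replicate (sum λs) 1
  all-ones [] _ _ = refl
  all-ones (x ∷ λs) (1≤x ∷ ps) (x≤1 ∷ qs) with ≤-antisym x≤1 1≤x
  ... | refl = cong (1 ∷_) (all-ones λs ps qs)

  split-top : ∀ a λs → Linked _≥_ λs → All (_≤ a) λs →
    Σ ℕ λ t → Σ (List ℕ) λ μ → λs ≡ replicate t a ++ μ × All (_< a) μ × Linked _≥_ μ
  split-top a [] l _ = 0 , [] , refl , [] , []
  split-top a (x ∷ λs) l (x≤a ∷ λs≤a) with x ≟ a
  ... | yes refl with split-top x λs (Linked.tail l) λs≤a
  ...   | t , μ , e , μ<a , lμ = suc t , μ , cong (x ∷_) e , μ<a , lμ
  split-top a (x ∷ λs) l (x≤a ∷ _) | no x≢a =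
    0 , x ∷ λs , refl , x<a ∷ All.map (λ y≤x → <-≤-trans (s≤s y≤x) x<a) (linked-below-head x λs l) , l
    where
    x<a : x < a
    x<a = ≤∧≢⇒< x≤a x≢a

  withTop-elim : ∀ k N t {λs} → λs ∈ withTop k N t →
    Σ (List ℕ) λ μ → suc (suc k) * t ≤ N × μ ∈ partitions k (N ∸ suc (suc k) * t) × λs ≡ replicate t (suc (suc k)) ++ μ
  withTop-elim k N t λs∈ with suc (suc k) * t ≤? N
  ... | no _ with λs∈
  ... | ()
  withTop-elim k N t λs∈ | yes top≤N with ∈-map⁻ (replicate t (suc (suc k)) ++_) λs∈
  ... | μ , μ∈ , refl = μ , top≤N , μ∈ , refl

  partitions-sound : ∀ k N λs → λs ∈ partitions k N → BoundedPartition N (suc k) λs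
  partitions-sound zero N λs (here refl) = (replicate⁺ N ≤-refl , ones N , trans (sum-replicate N 1) (*-identityʳ N)) , replicate⁺ N ≤-refl
    where
    ones : ∀ N → Linked _≥_ (replicate N 1)
    ones zero = []
    ones (suc zero) = [-]
    ones (suc (suc N)) = ≤-refl ∷ ones (suc N)
  partitions-sound (suc k) N λs λs∈ with ∈-concatMap-elim {g = withTop k N} (upTo (suc N)) λs∈
  ... | t , _ , λs∈t with withTop-elim k N t λs∈t
  ... | μ , top≤N , μ∈ , refl with partitions-sound k (N ∸ suc (suc k) * t) μ μ∈
  ... | (μ≥1 , lμ , sumμ) , μ≤ =
    (++⁺ (replicate⁺ t (s≤s z≤n)) μ≥1 ,
     linked-replicate t a μ lμ (All.map m≤n⇒m≤1+n μ≤) ,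
     trans (sum-++ (replicate t a) μ) (trans (cong₂ _+_ (trans (sum-replicate t a) (*-comm t a)) sumμ) (m+[n∸m]≡n top≤N))) ,
    ++⁺ (replicate⁺ t ≤-refl) (All.map m≤n⇒m≤1+n μ≤)
    where
    a : ℕ
    a = suc (suc k)

  top∉partition : ∀ k M {μ} → μ ∈ partitions k M → suc (suc k) ∉ μ
  top∉partition k M μ∈ top∈μ = 1+n≰n (All.lookup (proj₂ (partitions-sound k M _ μ∈)) top∈μ)

  partitions-complete : ∀ k N λs → BoundedPartition N (suc k) λs → λs ∈ partitions k N
  partitions-complete zero N λs ((λs≥1 , _ , sumλs) , λs≤1) = here (trans (all-ones λs λs≥1 λs≤1) (cong (λ z → replicate z 1) sumλs))
  partitions-complete (suc k) N λs ((λs≥1 , lλs , sumλs) , λs≤) with split-top (suc (suc k)) λs lλs λs≤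
  ... | t , μ , refl , μ< , lμ = ∈-concatMap-intro {g = withTop k N} (∈-upTo⁺ (s≤s t≤N)) inBlock
    where
    a : ℕ
    a = suc (suc k)
    sumμ : a * t + sum μ ≡ N
    sumμ = trans (cong (_+ sum μ) (trans (*-comm a t) (sym (sum-replicate t a)))) (trans (sym (sum-++ (replicate t a) μ)) sumλs)
    top≤N : a * t ≤ N
    top≤N = subst (a * t ≤_) sumμ (m≤m+n (a * t) (sum μ))
    t≤N : t ≤ N
    t≤N = ≤-trans (m≤n*m t a) top≤N
    μ-partition : BoundedPartition (N ∸ a * t) (suc k) μ
    μ-partition = (++⁻ʳ (replicate t a) λs≥1 , lμ , sym (trans (cong (_∸ a * t) (sym sumμ)) (m+n∸m≡n (a * t) (sum μ)))) ,
                  All.map ≤-pred μ<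
    inBlock : replicate t a ++ μ ∈ withTop k N t
    inBlock with a * t ≤? N
    ... | yes _ = ∈-map⁺ (replicate t a ++_) (partitions-complete k (N ∸ a * t) μ μ-partition)
    ... | no ¬top≤N = ⊥-elim (¬top≤N top≤N)

  partitions-unique : ∀ k N → Unique (partitions k N)
  partitions-unique zero N = [] ∷ []
  partitions-unique (suc k) N = unique-concatMap (upTo (suc N)) (upTo⁺ (suc N)) blocks-unique same-t
    where
    a : ℕ
    a = suc (suc k)
    blocks-unique : ∀ t → Unique (withTop k N t)
    blocks-unique t with a * t ≤? N
    ... | yes _ = map⁺ (λ {x} {y} → ++-cancelˡ (replicate t a) x y) (partitions-unique k (N ∸ a * t))
    ... | no _ = []
    -- t is recovered as the multiplicity of the top part.
    top-multiplicity : ∀ t λs → λs ∈ withTop k N t → freq a λs ≡ t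
    top-multiplicity t λs λs∈ with withTop-elim k N t λs∈
    ... | μ , _ , μ∈ , refl =
      trans (freq-replicate-same a t μ) (trans (cong (t +_) (freq-∉ a μ (top∉partition k _ μ∈))) (+-identityʳ t))
    same-t : ∀ {t t′ λs} → λs ∈ withTop k N t → λs ∈ withTop k N t′ → t ≡ t′
    same-t {t} {t′} {λs} λs∈ λs∈′ = trans (sym (top-multiplicity t λs λs∈)) (top-multiplicity t′ λs λs∈′)

-- For λ = (k+2)^t μ the term factors as
--   C(N,t) · falling (N−t) ((k+1)t) · (term of μ),
-- which matches the recursion of nilpotentCount; along the way every division
-- in `term` is shown to be exact.
module PartitionSums where

  open import Data.Nat
  open import Data.Nat.Properties
  open import Data.Nat.DivMod using (/-congˡ; m*n/n≡m)
  open import Data.List using (List; []; map; replicate; _++_; upTo; concatMap)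
  open import Data.List.Properties using (++-identityʳ)
  open import Data.List.Membership.Propositional using (_∈_; _∉_)
  open import Data.List.Relation.Unary.Any using (here)
  open import Relation.Nullary using (yes; no; ¬_)
  open import Relation.Binary.PropositionalEquality
  open import Data.Product using (_,_)
  open import Data.Empty using (⊥-elim)
  open import Data.Nat.Tactic.RingSolver using (solve-∀)
  open import Function using (id)
  open FiniteSums
  open VectorEnumeration using (∈-concatMap-elim)
  open Binomials
  open HeightVectorSums using (nilpotentCount)
  open FrequencyProducts using (freqFactProd-replicate)
  open BoundedPartitions
  open ≡-Reasoning

  term-from-product : ∀ N λs X → N ! ≡ X * freqFactProd λs → term N λs ≡ X
  term-from-product N λs X e = trans (/-congˡ {{freqFactProd≢0 λs}} e) (m*n/n≡m X (freqFactProd λs) {{freqFactProd≢0 λs}})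

  topCoefficient : ℕ → ℕ → ℕ → ℕ
  topCoefficient k N t = choose N t * falling (N ∸ t) (suc k * t)

  top-factorial : ∀ k N t → suc (suc k) * t ≤ N →
    topCoefficient k N t * t ! * (N ∸ suc (suc k) * t) ! ≡ N !
  top-factorial k N t top≤N = begin
    choose N t * falling (N ∸ t) (suc k * t) * t ! * rest !
      ≡⟨ cong (_* rest !) (swap (choose N t) (falling (N ∸ t) (suc k * t)) (t !)) ⟩
    choose N t * t ! * falling (N ∸ t) (suc k * t) * rest !
      ≡⟨ cong (λ z → z * falling (N ∸ t) (suc k * t) * rest !) (choose-! N t) ⟩
    falling N t * falling (N ∸ t) (suc k * t) * rest !
      ≡⟨ cong (_* rest !) (falling-+ N t (suc k * t)) ⟨
    falling N (suc (suc k) * t) * rest !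
      ≡⟨ falling-! N (suc (suc k) * t) top≤N ⟩
    N ! ∎
    where
    rest : ℕ
    rest = N ∸ suc (suc k) * t
    swap : ∀ a b c → a * b * c ≡ a * c * b
    swap = solve-∀

  top-term : ∀ k N t μ → suc (suc k) * t ≤ N → suc (suc k) ∉ μ →
    term (N ∸ suc (suc k) * t) μ * freqFactProd μ ≡ (N ∸ suc (suc k) * t) ! →
    N ! ≡ topCoefficient k N t * term (N ∸ suc (suc k) * t) μ * freqFactProd (replicate t (suc (suc k)) ++ μ)
  top-term k N t μ top≤N top∉μ μ-exact = begin
    N !                                          ≡⟨ top-factorial k N t top≤N ⟨
    B * t ! * M !                                ≡⟨ cong (B * t ! *_) μ-exact ⟨
    B * t ! * (term M μ * freqFactProd μ)        ≡⟨ interchange B (t !) (term M μ) (freqFactProd μ) ⟩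
    B * term M μ * (t ! * freqFactProd μ)        ≡⟨ cong (B * term M μ *_) (freqFactProd-replicate (suc (suc k)) t μ top∉μ) ⟨
    B * term M μ * freqFactProd (replicate t (suc (suc k)) ++ μ) ∎
    where
    B : ℕ
    B = topCoefficient k N t
    M : ℕ
    M = N ∸ suc (suc k) * t
    interchange : ∀ p q r s → p * q * (r * s) ≡ p * r * (q * s)
    interchange = solve-∀

  ones-factorial : ∀ N → N ! ≡ freqFactProd (replicate N 1)
  ones-factorial N = sym (begin
    freqFactProd (replicate N 1)        ≡⟨ cong freqFactProd (++-identityʳ (replicate N 1)) ⟨
    freqFactProd (replicate N 1 ++ [])  ≡⟨ freqFactProd-replicate 1 N [] (λ ()) ⟩
    N ! * 1                             ≡⟨ *-identityʳ (N !) ⟩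
    N !                                 ∎)

  term-ones : ∀ N → term N (replicate N 1) ≡ 1
  term-ones N = term-from-product N (replicate N 1) 1 (trans (ones-factorial N) (sym (*-identityˡ _)))

  -- Every division performed by `term` on an enumerated partition is exact.
  term-exact : ∀ k N λs → λs ∈ partitions k N → term N λs * freqFactProd λs ≡ N !
  term-exact zero N λs (here refl) =
    trans (cong (_* freqFactProd (replicate N 1)) (term-ones N)) (trans (*-identityˡ _) (sym (ones-factorial N)))
  term-exact (suc k) N λs λs∈ with ∈-concatMap-elim {g = withTop k N} (upTo (suc N)) λs∈
  ... | t , _ , λs∈t with withTop-elim k N t λs∈t
  ... | μ , top≤N , μ∈ , refl =
    trans (cong (_* freqFactProd λs′) (term-from-product N λs′ (topCoefficient k N t * term M μ) N!≡)) (sym N!≡)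
    where
    λs′ : List ℕ
    λs′ = replicate t (suc (suc k)) ++ μ
    M : ℕ
    M = N ∸ suc (suc k) * t
    N!≡ : N ! ≡ topCoefficient k N t * term M μ * freqFactProd λs′
    N!≡ = top-term k N t μ top≤N (top∉partition k M μ∈) (term-exact k M μ μ∈)

  withTop-sum : ∀ k N t → (∀ M → ∑ (term M) (partitions k M) ≡ nilpotentCount k M) →
    ∑ (term N) (withTop k N t) ≡ topCoefficient k N t * nilpotentCount k (N ∸ t ∸ suc k * t)
  withTop-sum k N t sumₖ with suc (suc k) * t ≤? N
  ... | yes top≤N = begin
    ∑ (term N) (map (replicate t a ++_) (partitions k M))  ≡⟨ ∑-map (term N) (replicate t a ++_) (partitions k M) ⟩
    ∑ (λ μ → term N (replicate t a ++ μ)) (partitions k M)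
      ≡⟨ ∑-cong (partitions k M) (λ {μ} μ∈ → term-from-product N (replicate t a ++ μ) _
           (top-term k N t μ top≤N (top∉partition k M μ∈) (term-exact k M μ μ∈))) ⟩
    ∑ (λ μ → B * term M μ) (partitions k M)                ≡⟨ ∑-* B (term M) (partitions k M) ⟩
    B * ∑ (term M) (partitions k M)                        ≡⟨ cong (B *_) (sumₖ M) ⟩
    B * nilpotentCount k M                                 ≡⟨ cong (λ z → B * nilpotentCount k z) (∸-+-assoc N t (suc k * t)) ⟨
    B * nilpotentCount k (N ∸ t ∸ suc k * t)               ∎
    where
    a : ℕ
    a = suc (suc k)
    M : ℕ
    M = N ∸ a * t
    B : ℕ
    B = topCoefficient k N t
  ... | no ¬top≤N = sym (begin
    choose N t * falling (N ∸ t) (suc k * t) * nilpotentCount k (N ∸ t ∸ suc k * t)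
      ≡⟨ cong (λ z → choose N t * z * nilpotentCount k (N ∸ t ∸ suc k * t)) (falling-zero (N ∸ t) (suc k * t) tooShort) ⟩
    choose N t * 0 * nilpotentCount k (N ∸ t ∸ suc k * t)
      ≡⟨ cong (_* nilpotentCount k (N ∸ t ∸ suc k * t)) (*-zeroʳ (choose N t)) ⟩
    0 ∎)
    where
    topNonZero : ∀ t → ¬ (suc (suc k) * t ≤ N) → NonZero (suc k * t)
    topNonZero zero ¬0≤N = ⊥-elim (¬0≤N (subst (_≤ N) (sym (*-zeroʳ (suc (suc k)))) z≤n))
    topNonZero (suc t) _ = _
    -- Fewer than (k+1)t points remain for the lower parts of the top paths.
    tooShort : N ∸ t < suc k * t
    tooShort = m<n+o⇒m∸n<o N t {{topNonZero t ¬top≤N}} (≰⇒> ¬top≤N)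

  partition-sum : ∀ k N → ∑ (term N) (partitions k N) ≡ nilpotentCount k N
  partition-sum zero N = cong (_+ 0) (term-ones N)
  partition-sum (suc k) N = begin
    ∑ (term N) (concatMap (withTop k N) (upTo (suc N)))   ≡⟨ ∑-concatMap (term N) (withTop k N) (upTo (suc N)) ⟩
    ∑ (λ t → ∑ (term N) (withTop k N t)) (upTo (suc N))   ≡⟨ ∑-applyUpTo _ id (suc N) ⟩
    ∑< (suc N) (λ t → ∑ (term N) (withTop k N t))         ≡⟨ ∑<-cong (suc N) (λ t _ → withTop-sum k N t (partition-sum k)) ⟩
    nilpotentCount (suc k) N                              ∎

-- The candidates are
-- duplicate-free and contain every bounded partition, so the filtered list
-- has the same elements as `partitions`, each once, and the sums agree.
module Candidates where

  open import Data.Nat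
  open import Data.Nat.Properties
  open import Data.List using (List; []; _∷_; map; filter; length; upTo; applyUpTo)
  open import Data.List.Membership.Propositional using (_∈_)
  open import Data.List.Membership.Propositional.Properties using (∈-map⁺; ∈-map⁻; ∈-upTo⁺; ∈-filter⁺; ∈-filter⁻; ∈-applyUpTo⁺)
  open import Data.List.Relation.Unary.All as All using (All; []; _∷_) renaming (all? to allL?)
  open import Data.List.Relation.Unary.Linked using (linked?)
  open import Data.List.Relation.Unary.Unique.Propositional using (Unique)
  open import Data.List.Relation.Unary.Unique.Propositional.Properties using (map⁺; upTo⁺; filter⁺; applyUpTo⁺₁)
  open import Data.Vec using (Vec; toList; fromList)
  open import Data.Vec.Properties using (toList-injective; cast-is-id; length-toList; toList∘fromList)
  open import Data.Vec.Relation.Unary.All.Properties using (fromList⁺)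
  open import Data.Nat.ListAction using (sum)
  open import Relation.Nullary using (Dec; _×-dec_)
  open import Relation.Binary.PropositionalEquality
  open import Data.Product using (_,_; proj₂)
  open FiniteSums using (∑; sum-map; ∑-unique)
  open VectorEnumeration using (∈-concatMap-intro; unique-concatMap; ∈-vecsOver; unique-vecsOver)
  open BoundedPartitions

  boundedPartition? : ∀ N K λs → Dec (BoundedPartition N K λs)
  boundedPartition? N K λs = (allL? (_≥? 1) λs ×-dec (linked? _≥?_ λs ×-dec (sum λs ≟ N))) ×-dec allL? (_≤? K) λs

  toList-inj : ∀ {m} (v w : Vec ℕ m) → toList v ≡ toList w → v ≡ w
  toList-inj v w e = trans (sym (cast-is-id refl v)) (toList-injective refl v w e)

  candidates-unique : ∀ N → Unique (candidates N)
  candidates-unique N = unique-concatMap (upTo (suc N)) (upTo⁺ (suc N))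
    (λ m → map⁺ (λ {v} {w} → toList-inj v w) (unique-vecsOver (applyUpTo suc N) m (applyUpTo⁺₁ suc N (λ i<j _ e → <⇒≢ i<j (suc-injective e)))))
    sameLength
    where
    sameLength : ∀ {m m′ v} → v ∈ map toList (vecsOver (applyUpTo suc N) m) → v ∈ map toList (vecsOver (applyUpTo suc N) m′) → m ≡ m′
    sameLength p q with ∈-map⁻ toList p | ∈-map⁻ toList q
    ... | w , _ , refl | w′ , _ , e = trans (sym (length-toList w)) (trans (cong length e) (length-toList w′))

  length≤sum : ∀ λs → All (_≥ 1) λs → length λs ≤ sum λs
  length≤sum [] _ = z≤n
  length≤sum (x ∷ λs) (1≤x ∷ ps) = +-mono-≤ 1≤x (length≤sum λs ps)

  parts≤sum : ∀ λs → All (_≤ sum λs) λs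
  parts≤sum [] = []
  parts≤sum (x ∷ λs) = m≤m+n x (sum λs) ∷ All.map (λ y≤ → ≤-trans y≤ (m≤n+m (sum λs) x)) (parts≤sum λs)

  candidates-complete : ∀ N K λs → BoundedPartition N K λs → λs ∈ candidates N
  candidates-complete N K λs ((λs≥1 , _ , sumλs) , _) =
    subst (_∈ candidates N) (toList∘fromList λs)
      (∈-concatMap-intro {g = λ m → map toList (vecsOver (applyUpTo suc N) m)}
        (∈-upTo⁺ (s≤s (subst (length λs ≤_) sumλs (length≤sum λs λs≥1))))
        (∈-map⁺ toList (∈-vecsOver (applyUpTo suc N) (fromList λs) (fromList⁺ entries))))
    where
    inRange : ∀ {a} → a ≥ 1 → a ≤ N → a ∈ applyUpTo suc N
    inRange {suc i} _ a≤N = ∈-applyUpTo⁺ suc a≤N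
    entries : All (_∈ applyUpTo suc N) λs
    entries = All.zipWith (λ (a≥1 , a≤) → inRange a≥1 (subst (_ ≤_) sumλs a≤)) (λs≥1 , parts≤sum λs)

  filtered-sum : ∀ k N → sum (map (term N) (partitionsWithMax≤ N (suc k))) ≡ ∑ (term N) (partitions k N)
  filtered-sum k N =
    trans (sum-map (term N) filtered)
          (∑-unique (term N) filtered (partitions k N) (filter⁺ (boundedPartition? N (suc k)) (candidates-unique N)) (partitions-unique k N) to from)
    where
    filtered : List (List ℕ)
    filtered = filter (boundedPartition? N (suc k)) (candidates N)
    to : ∀ {λs} → λs ∈ filtered → λs ∈ partitions k N
    to {λs} λs∈ = partitions-complete k N λs (proj₂ (∈-filter⁻ (boundedPartition? N (suc k)) {xs = candidates N} λs∈))
    from : ∀ {λs} → λs ∈ partitions k N → λs ∈ filtered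
    from {λs} λs∈ = ∈-filter⁺ (boundedPartition? N (suc k)) {xs = candidates N}
                      (candidates-complete N (suc k) λs bounded) bounded
      where
      bounded : BoundedPartition N (suc k) λs
      bounded = partitions-sound k N λs λs∈

proposition2 : (k n : ℕ) →
    r {suc n} (suc k) emptyₚ ≡ sum (map (term (suc n)) (partitionsWithMax≤ (suc n) (suc k)))
proposition2 k n = begin
  r {suc n} (suc k) emptyₚ                                          ≡⟨ CountByHeights.r-nilpotentCount k (suc n) ⟩
  HeightVectorSums.nilpotentCount k (suc n)                         ≡⟨ PartitionSums.partition-sum k (suc n) ⟨
  FiniteSums.∑ (term (suc n)) (BoundedPartitions.partitions k (suc n)) ≡⟨ Candidates.filtered-sum k (suc n) ⟨
  sum (map (term (suc n)) (partitionsWithMax≤ (suc n) (suc k)))     ∎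
  where open ≡.≡-Reasoning
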